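{- As an identity of formal power series in $x,y,q$, \begin{align*} \frac{(-x;q)_\infty (xy;q)_\infty}{(x^2yq^2;q^2)_\infty} = \sum_{n\ge 0} \frac{x^n q^{\binom{n}{2}}(1-x^2y^2q^{4n})(xy;q)_n (y;q^2)_n}{(q;q)_n(x^2yq^2;q^2)_n}. \end{align*}
   Context: For $n\in\mathbb{N}\cup\{\infty\}$, $(A;q)_n:=\prod_{k=0}^{n-1}(1-Aq^k)$. -}

module Defs where

open import Data.Nat as ℕ using (ℕ; zero; suc; _≟_)
open import Data.Nat.Combinatorics using (_C_)
open import Data.Integer as ℤ using (ℤ; +_; 0ℤ; 1ℤ)
open import Relation.Nullary using (yes; no)
open import Relation.Binary.PropositionalEquality using (_≡_)

-- Formal power series in three commuting variables x, y, q with integer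
-- coefficients: (F a b c) is the coefficient of x^a y^b q^c.
Series : Set
Series = ℕ → ℕ → ℕ → ℤ

_≈_ : Series → Series → Set
F ≈ G = ∀ a b c → F a b c ≡ G a b c
infix 4 _≈_

sumLe : ℕ → (ℕ → ℤ) → ℤ
sumLe zero f = f 0
sumLe (suc n) f = sumLe n f ℤ.+ f (suc n)

mono : ℤ → ℕ → ℕ → ℕ → Series
mono e i j k a b c with a ≟ i | b ≟ j | c ≟ k
... | yes _ | yes _ | yes _ = e
... | _ | _ | _ = 0ℤ

1s : Series
1s = mono 1ℤ 0 0 0

X Y Q : Series
X = mono 1ℤ 1 0 0
Y = mono 1ℤ 0 1 0
Q = mono 1ℤ 0 0 1

infixl 6 _+s_ _-s_
infixl 7 _*s_

_+s_ : Series → Series → Series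
(F +s G) a b c = F a b c ℤ.+ G a b c

-s_ : Series → Series
(-s F) a b c = ℤ.- F a b c

_-s_ : Series → Series → Series
F -s G = F +s (-s G)

_*s_ : Series → Series → Series
(F *s G) a b c =
  sumLe a λ i → sumLe b λ j → sumLe c λ k →
    F i j k ℤ.* G (a ℕ.∸ i) (b ℕ.∸ j) (c ℕ.∸ k)

_^s_ : Series → ℕ → Series
F ^s zero = 1s
F ^s suc n = F *s (F ^s n)

-- Multiplicative inverse of a series P with constant term 1:
-- 1/P = Σ_{t≥0} (1 - P)^t.  Since (1-P)^t has total degree ≥ t, the
-- coefficient of x^a y^b q^c only involves t ≤ a+b+c.
inv : Series → Series
inv P a b c = sumLe (a ℕ.+ b ℕ.+ c) λ t → ((1s -s P) ^s t) a b c

poch : Series → ℕ → ℕ → Series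
poch A s zero = 1s
poch A s (suc n) = poch A s n *s (1s -s A *s (Q ^s (s ℕ.* n)))

-- infinite q-Pochhammer (A; q^s)_∞ for s ≥ 1 (only used with s = 1, 2):
-- the factors with index k > c are ≡ 1 mod q^{c+1}, so the coefficient of
-- x^a y^b q^c of the infinite product equals that of the first c+1 factors.
pochInf : Series → ℕ → Series
pochInf A s a b c = poch A s (suc c) a b c

-- Sum Σ_{n≥0} T n of a family with T n divisible by x^n (x-adically
-- convergent): the coefficient of x^a y^b q^c only involves n ≤ a.
sumX : (ℕ → Series) → Series
sumX T a b c = sumLe a λ n → T n a b c

LHS : Series
LHS = pochInf (-s X) 1 *s pochInf (X *s Y) 1
      *s inv (pochInf (X ^s 2 *s Y *s Q ^s 2) 2)

term : ℕ → Series
term n = X ^s n *s Q ^s (n C 2)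
         *s (1s -s X ^s 2 *s Y ^s 2 *s Q ^s (4 ℕ.* n))
         *s poch (X *s Y) 1 n *s poch Y 2 n
         *s inv (poch Q 1 n *s poch (X ^s 2 *s Y *s Q ^s 2) 2 n)

RHS : Series
RHS = sumX term

-- Both sides are power series F in x over ℤ[[y, q]] with constant term 1 satisfying the
-- q-difference equation (1 + x)(1 - xy) F(xq) = (1 - x²yq²) F(x).  For the product this is the
-- shift (A; q^s)_∞ = (1 - A)(Aq^s; q^s)_∞ applied to each factor.  For the sum, the n-th summand
-- T_n satisfies (1 + x)(1 - xy) T_n(xq) - (1 - x²yq²) T_n(x) = G_{n+1} - G_n with
-- G_n = (1 - x²yq²) x^n q^C(n,2) (1 + xyq^{2n}) (1 - q^n) (xy;q)_n (y;q²)_n / ((q;q)_n (x²yq²;q²)_n),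
-- so the sum telescopes to 0 since G_0 = 0.  Finally, if F(0) = 0 and F solves the equation,
-- comparing coefficients of x^m gives q^m F_m = F_m, so F = 0.
module Submission where

open import Level using (0ℓ; _⊔_)
open import Algebra.Bundles using (CommutativeRing)
open import Algebra.Solver.Ring.AlmostCommutativeRing using (fromCommutativeRing; _-Raw-AlmostCommutative⟶_)
import Algebra.Solver.Ring as RingSolver
open import Data.Maybe using (Maybe; just; nothing)
open import Data.Nat as ℕ using (ℕ; zero; suc; _∸_; z≤n; s≤s)
import Data.Nat.Properties as ℕ
open import Data.Nat.Combinatorics using (_C_; nC1≡n; nCk+nC[k+1]≡[n+1]C[k+1])
open import Data.Nat.Induction using (<-rec)
open import Data.Integer as ℤ using (ℤ; 0ℤ; 1ℤ)
import Data.Integer.Properties as ℤ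
open import Data.Product using (_,_)
open import Data.Sum using (inj₁; inj₂)
open import Relation.Binary.PropositionalEquality as ≡ using (_≡_)
open import Relation.Nullary using (yes; no)

module _ {c ℓ} (R : CommutativeRing c ℓ) where
  open CommutativeRing R
  open import Algebra.Properties.Semiring.Exp semiring using (_^_)

  PowersFixOnlyZero : Carrier → Set (c ⊔ ℓ)
  PowersFixOnlyZero u = ∀ {m} r → 1 ℕ.≤ m → u ^ m * r ≈ r → r ≈ 0#

module FiniteSums {c ℓ} (R : CommutativeRing c ℓ) where
  open CommutativeRing R
  open import Relation.Binary.Reasoning.Setoid setoid
  open import Algebra.Properties.CommutativeSemigroup +-commutativeSemigroup using (interchange)
  open import Algebra.Properties.AbelianGroup +-abelianGroup using (⁻¹-∙-comm)

  ∑≤ : ℕ → (ℕ → Carrier) → Carrier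
  ∑≤ zero f = f 0
  ∑≤ (suc n) f = ∑≤ n f + f (suc n)

  syntax ∑≤ n (λ i → f) = ∑[ i ≤ n ] f

  ∑≤-cong : ∀ n {f g} → (∀ i → i ℕ.≤ n → f i ≈ g i) → ∑≤ n f ≈ ∑≤ n g
  ∑≤-cong zero f≈g = f≈g 0 z≤n
  ∑≤-cong (suc n) f≈g =
    +-cong (∑≤-cong n (λ i i≤n → f≈g i (ℕ.m≤n⇒m≤1+n i≤n))) (f≈g (suc n) ℕ.≤-refl)

  ∑≤-zero : ∀ n {f} → (∀ i → i ℕ.≤ n → f i ≈ 0#) → ∑≤ n f ≈ 0#
  ∑≤-zero zero f≈0 = f≈0 0 z≤n
  ∑≤-zero (suc n) f≈0 =
    trans (+-cong (∑≤-zero n (λ i i≤n → f≈0 i (ℕ.m≤n⇒m≤1+n i≤n))) (f≈0 (suc n) ℕ.≤-refl))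
          (+-identityˡ 0#)

  ∑≤-distrib-+ : ∀ n f g → ∑[ i ≤ n ] (f i + g i) ≈ ∑≤ n f + ∑≤ n g
  ∑≤-distrib-+ zero f g = refl
  ∑≤-distrib-+ (suc n) f g = trans (+-cong (∑≤-distrib-+ n f g) refl) (interchange _ _ _ _)

  -‿distrib-∑≤ : ∀ n f → - ∑≤ n f ≈ ∑[ i ≤ n ] (- f i)
  -‿distrib-∑≤ zero f = refl
  -‿distrib-∑≤ (suc n) f = trans (sym (⁻¹-∙-comm _ _)) (+-cong (-‿distrib-∑≤ n f) refl)

  *-distribˡ-∑≤ : ∀ n x f → x * ∑≤ n f ≈ ∑[ i ≤ n ] (x * f i)
  *-distribˡ-∑≤ zero x f = refl
  *-distribˡ-∑≤ (suc n) x f = trans (distribˡ x _ _) (+-cong (*-distribˡ-∑≤ n x f) refl)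

  *-distribʳ-∑≤ : ∀ n x f → ∑≤ n f * x ≈ ∑[ i ≤ n ] (f i * x)
  *-distribʳ-∑≤ zero x f = refl
  *-distribʳ-∑≤ (suc n) x f = trans (distribʳ x _ _) (+-cong (*-distribʳ-∑≤ n x f) refl)

  ∑≤-head : ∀ n f → ∑≤ (suc n) f ≈ f 0 + ∑[ i ≤ n ] f (suc i)
  ∑≤-head zero f = refl
  ∑≤-head (suc n) f = trans (+-cong (∑≤-head n f) refl) (+-assoc _ _ _)

  ∑≤-reverse : ∀ n f → ∑≤ n f ≈ ∑[ i ≤ n ] f (n ∸ i)
  ∑≤-reverse zero f = refl
  ∑≤-reverse (suc n) f =
    trans (+-cong (∑≤-reverse n f) refl) (trans (+-comm _ _) (sym (∑≤-head n (λ i → f (suc n ∸ i)))))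

  ∑≤-extend : ∀ {m} n f → m ℕ.≤ n → (∀ i → m ℕ.< i → i ℕ.≤ n → f i ≈ 0#) → ∑≤ m f ≈ ∑≤ n f
  ∑≤-extend zero f z≤n f≈0 = refl
  ∑≤-extend (suc n) f m≤1+n f≈0 with ℕ.m≤n⇒m<n∨m≡n m≤1+n
  ... | inj₂ ≡.refl = refl
  ... | inj₁ (s≤s m≤n) =
    trans (∑≤-extend n f m≤n (λ i m<i i≤n → f≈0 i m<i (ℕ.m≤n⇒m≤1+n i≤n)))
          (trans (sym (+-identityʳ _)) (+-cong refl (sym (f≈0 (suc n) (s≤s m≤n) ℕ.≤-refl))))

  ∑≤-first : ∀ n f → (∀ i → 0 ℕ.< i → i ℕ.≤ n → f i ≈ 0#) → ∑≤ n f ≈ f 0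
  ∑≤-first n f f≈0 = sym (∑≤-extend n f z≤n f≈0)

  ∑≤-swap : ∀ m n (f : ℕ → ℕ → Carrier) → ∑[ i ≤ m ] ∑[ j ≤ n ] f i j ≈ ∑[ j ≤ n ] ∑[ i ≤ m ] f i j
  ∑≤-swap zero n f = refl
  ∑≤-swap (suc m) n f = trans (+-cong (∑≤-swap m n f) refl) (sym (∑≤-distrib-+ n _ _))

  ∑≤-triangle : ∀ n (f : ℕ → ℕ → Carrier) →
                ∑[ k ≤ n ] ∑[ i ≤ k ] f i k ≈ ∑[ i ≤ n ] ∑[ j ≤ n ∸ i ] f i (i ℕ.+ j)
  ∑≤-triangle zero f = refl
  ∑≤-triangle (suc n) f = begin
      ∑[ k ≤ n ] ∑[ i ≤ k ] f i k + (∑[ i ≤ n ] f i (suc n) + f (suc n) (suc n))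
    ≈⟨ +-cong (∑≤-triangle n f) refl ⟩
      ∑[ i ≤ n ] ∑[ j ≤ n ∸ i ] f i (i ℕ.+ j) + (∑[ i ≤ n ] f i (suc n) + f (suc n) (suc n))
    ≈⟨ sym (+-assoc _ _ _) ⟩
      ∑[ i ≤ n ] ∑[ j ≤ n ∸ i ] f i (i ℕ.+ j) + ∑[ i ≤ n ] f i (suc n) + f (suc n) (suc n)
    ≈⟨ +-cong (sym (∑≤-distrib-+ n _ _)) corner ⟩
      ∑[ i ≤ n ] (∑[ j ≤ n ∸ i ] f i (i ℕ.+ j) + f i (suc n)) + ∑[ j ≤ n ∸ n ] f (suc n) (suc n ℕ.+ j)
    ≈⟨ +-cong (∑≤-cong n row) refl ⟩
      ∑[ i ≤ suc n ] ∑[ j ≤ suc n ∸ i ] f i (i ℕ.+ j)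
    ∎
    where
    corner : f (suc n) (suc n) ≈ ∑[ j ≤ n ∸ n ] f (suc n) (suc n ℕ.+ j)
    corner rewrite ℕ.n∸n≡0 n | ℕ.+-identityʳ n = refl
    row : ∀ i → i ℕ.≤ n →
          ∑[ j ≤ n ∸ i ] f i (i ℕ.+ j) + f i (suc n) ≈ ∑[ j ≤ suc n ∸ i ] f i (i ℕ.+ j)
    row i i≤n = sym (trans (reflexive (≡.cong (λ m → ∑≤ m (λ j → f i (i ℕ.+ j))) (ℕ.+-∸-assoc 1 i≤n)))
                           (+-cong refl (reflexive (≡.cong (f i) i+[1+n∸i]≡1+n))))
      where
      i+[1+n∸i]≡1+n : i ℕ.+ suc (n ∸ i) ≡ suc n
      i+[1+n∸i]≡1+n = ≡.trans (ℕ.+-suc i (n ∸ i)) (≡.cong suc (ℕ.m+[n∸m]≡n i≤n))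

  ∑≤-telescope : ∀ n (g : ℕ → Carrier) → ∑[ k ≤ n ] (g (suc k) - g k) ≈ g (suc n) - g 0
  ∑≤-telescope zero g = refl
  ∑≤-telescope (suc n) g = begin
      ∑[ k ≤ n ] (g (suc k) - g k) + (g (suc (suc n)) - g (suc n))
    ≈⟨ +-cong (∑≤-telescope n g) refl ⟩
      (g (suc n) - g 0) + (g (suc (suc n)) - g (suc n))
    ≈⟨ +-comm _ _ ⟩
      (g (suc (suc n)) - g (suc n)) + (g (suc n) - g 0)
    ≈⟨ +-assoc _ _ _ ⟩
      g (suc (suc n)) + (- g (suc n) + (g (suc n) - g 0))
    ≈⟨ +-cong refl (sym (+-assoc _ _ _)) ⟩
      g (suc (suc n)) + ((- g (suc n) + g (suc n)) - g 0)
    ≈⟨ +-cong refl (trans (+-cong (-‿inverseˡ _) refl) (+-identityˡ _)) ⟩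
      g (suc (suc n)) - g 0
    ∎

module PowerSeries {c ℓ} (R : CommutativeRing c ℓ) where
  open CommutativeRing R
  open FiniteSums R
  open import Relation.Binary.Reasoning.Setoid setoid
  open import Algebra.Properties.Semiring.Exp semiring using (_^_; ^-homo-*)
  open import Algebra.Properties.Ring ring using (-‿distribʳ-*; -0#≈0#)

  PS : Set c
  PS = ℕ → Carrier

  infix 4 _≈ₚ_
  infixl 6 _+ₚ_
  infixl 7 _*ₚ_

  _≈ₚ_ : PS → PS → Set ℓ
  F ≈ₚ G = ∀ n → F n ≈ G n

  _+ₚ_ : PS → PS → PS
  (F +ₚ G) n = F n + G n

  -ₚ_ : PS → PS
  (-ₚ F) n = - F n

  0ₚ : PS
  0ₚ _ = 0#

  1ₚ : PS
  1ₚ zero = 1#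
  1ₚ (suc _) = 0#

  _*ₚ_ : PS → PS → PS
  (F *ₚ G) n = ∑[ i ≤ n ] (F i * G (n ∸ i))

  *ₚ-cong : ∀ {F F′ G G′} → F ≈ₚ F′ → G ≈ₚ G′ → F *ₚ G ≈ₚ F′ *ₚ G′
  *ₚ-cong F≈F′ G≈G′ n = ∑≤-cong n (λ i _ → *-cong (F≈F′ i) (G≈G′ (n ∸ i)))

  *ₚ-comm : ∀ F G → F *ₚ G ≈ₚ G *ₚ F
  *ₚ-comm F G n = trans (∑≤-reverse n _) (∑≤-cong n (λ i i≤n →
    trans (*-cong refl (reflexive (≡.cong G (ℕ.m∸[m∸n]≡n i≤n)))) (*-comm _ _)))

  *ₚ-identityˡ : ∀ F → 1ₚ *ₚ F ≈ₚ F
  *ₚ-identityˡ F zero = *-identityˡ _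
  *ₚ-identityˡ F (suc n) = trans (∑≤-head n _)
    (trans (+-cong (*-identityˡ _) (∑≤-zero n (λ i _ → zeroˡ _))) (+-identityʳ _))

  *ₚ-distribˡ : ∀ F G H → F *ₚ (G +ₚ H) ≈ₚ F *ₚ G +ₚ F *ₚ H
  *ₚ-distribˡ F G H n = trans (∑≤-cong n (λ i _ → distribˡ _ _ _)) (∑≤-distrib-+ n _ _)

  *ₚ-distribʳ : ∀ F G H → (G +ₚ H) *ₚ F ≈ₚ G *ₚ F +ₚ H *ₚ F
  *ₚ-distribʳ F G H n = trans (∑≤-cong n (λ i _ → distribʳ _ _ _)) (∑≤-distrib-+ n _ _)

  *ₚ-assoc : ∀ F G H → (F *ₚ G) *ₚ H ≈ₚ F *ₚ (G *ₚ H)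
  *ₚ-assoc F G H n = begin
      ∑[ k ≤ n ] (∑[ i ≤ k ] (F i * G (k ∸ i)) * H (n ∸ k))
    ≈⟨ ∑≤-cong n (λ k _ → *-distribʳ-∑≤ k _ _) ⟩
      ∑[ k ≤ n ] ∑[ i ≤ k ] (F i * G (k ∸ i) * H (n ∸ k))
    ≈⟨ ∑≤-triangle n (λ i k → F i * G (k ∸ i) * H (n ∸ k)) ⟩
      ∑[ i ≤ n ] ∑[ j ≤ n ∸ i ] (F i * G (i ℕ.+ j ∸ i) * H (n ∸ (i ℕ.+ j)))
    ≈⟨ ∑≤-cong n (λ i _ → ∑≤-cong (n ∸ i) (λ j _ →
         trans (*-cong (*-cong refl (reflexive (≡.cong G (ℕ.m+n∸m≡n i j))))
                       (reflexive (≡.cong H (≡.sym (ℕ.∸-+-assoc n i j)))))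
               (*-assoc _ _ _))) ⟩
      ∑[ i ≤ n ] ∑[ j ≤ n ∸ i ] (F i * (G j * H (n ∸ i ∸ j)))
    ≈⟨ ∑≤-cong n (λ i _ → sym (*-distribˡ-∑≤ (n ∸ i) _ _)) ⟩
      ∑[ i ≤ n ] (F i * ∑[ j ≤ n ∸ i ] (G j * H (n ∸ i ∸ j)))
    ∎

  R[[t]] : CommutativeRing c ℓ
  R[[t]] = record
    { Carrier = PS ; _≈_ = _≈ₚ_ ; _+_ = _+ₚ_ ; _*_ = _*ₚ_ ; -_ = -ₚ_ ; 0# = 0ₚ ; 1# = 1ₚ
    ; isCommutativeRing = record
      { isRing = record
        { +-isAbelianGroup = record
          { isGroup = record
            { isMonoid = record
              { isSemigroup = record
                { isMagma = record
                  { isEquivalence = record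
                    { refl = λ _ → refl ; sym = λ p n → sym (p n) ; trans = λ p q n → trans (p n) (q n) }
                  ; ∙-cong = λ p q n → +-cong (p n) (q n) }
                ; assoc = λ _ _ _ _ → +-assoc _ _ _ }
              ; identity = (λ _ _ → +-identityˡ _) , (λ _ _ → +-identityʳ _) }
            ; inverse = (λ _ _ → -‿inverseˡ _) , (λ _ _ → -‿inverseʳ _)
            ; ⁻¹-cong = λ p n → -‿cong (p n) }
          ; comm = λ _ _ _ → +-comm _ _ }
        ; *-cong = *ₚ-cong
        ; *-assoc = *ₚ-assoc
        ; *-identity = *ₚ-identityˡ , (λ F n → trans (*ₚ-comm F 1ₚ n) (*ₚ-identityˡ F n))
        ; distrib = *ₚ-distribˡ , *ₚ-distribʳ }
      ; *-comm = *ₚ-comm } }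

  open import Algebra.Properties.Semiring.Exp (CommutativeRing.semiring R[[t]])
    public using () renaming (_^_ to _^ₚ_)

  const : Carrier → PS
  const x zero = x
  const x (suc _) = 0#

  const-cong : ∀ {x y} → x ≈ y → const x ≈ₚ const y
  const-cong x≈y zero = x≈y
  const-cong x≈y (suc n) = refl

  const-*ₚ : ∀ x F → const x *ₚ F ≈ₚ λ n → x * F n
  const-*ₚ x F zero = refl
  const-*ₚ x F (suc n) =
    trans (∑≤-head n _) (trans (+-cong refl (∑≤-zero n (λ i _ → zeroˡ _))) (+-identityʳ _))

  const-homo-* : ∀ x y → const (x * y) ≈ₚ const x *ₚ const y
  const-homo-* x y zero = refl
  const-homo-* x y (suc n) = sym (trans (const-*ₚ x (const y) (suc n)) (zeroʳ _))

  ∑≤ₚ-coeff : ∀ n (f : ℕ → PS) m → FiniteSums.∑≤ R[[t]] n f m ≈ ∑[ i ≤ n ] f i m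
  ∑≤ₚ-coeff zero f m = refl
  ∑≤ₚ-coeff (suc n) f m = +-cong (∑≤ₚ-coeff n f m) refl

  t : PS
  t zero = 0#
  t (suc zero) = 1#
  t (suc (suc _)) = 0#

  t*ₚ-zero : ∀ F → (t *ₚ F) 0 ≈ 0#
  t*ₚ-zero F = zeroˡ _

  t*ₚ-suc : ∀ F n → (t *ₚ F) (suc n) ≈ F n
  t*ₚ-suc F zero = trans (+-cong (zeroˡ _) (*-identityˡ _)) (+-identityˡ _)
  t*ₚ-suc F (suc n) = begin
      (t *ₚ F) (suc (suc n))
    ≈⟨ ∑≤-head (suc n) _ ⟩
      0# * F (suc (suc n)) + ∑[ i ≤ suc n ] (t (suc i) * F (suc n ∸ i))
    ≈⟨ trans (+-cong (zeroˡ _) (∑≤-head n _)) (+-identityˡ _) ⟩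
      1# * F (suc n ∸ 0) + ∑[ i ≤ n ] (0# * F (n ∸ i))
    ≈⟨ trans (+-cong (*-identityˡ _) (∑≤-zero n (λ i _ → zeroˡ _))) (+-identityʳ _) ⟩
      F (suc n)
    ∎

  t^-*ₚ-below : ∀ a F n → n ℕ.< a → (t ^ₚ a *ₚ F) n ≈ 0#
  t^-*ₚ-below (suc a) F zero _ = trans (*ₚ-assoc t (t ^ₚ a) F 0) (t*ₚ-zero (t ^ₚ a *ₚ F))
  t^-*ₚ-below (suc a) F (suc n) (s≤s n<a) =
    trans (*ₚ-assoc t (t ^ₚ a) F (suc n)) (trans (t*ₚ-suc (t ^ₚ a *ₚ F) n) (t^-*ₚ-below a F n n<a))

  t^-*ₚ-shift : ∀ a F m → (t ^ₚ a *ₚ F) (a ℕ.+ m) ≈ F m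
  t^-*ₚ-shift zero F m = *ₚ-identityˡ F m
  t^-*ₚ-shift (suc a) F m =
    trans (*ₚ-assoc t (t ^ₚ a) F (suc (a ℕ.+ m))) (trans (t*ₚ-suc (t ^ₚ a *ₚ F) (a ℕ.+ m)) (t^-*ₚ-shift a F m))

  const-1 : const 1# ≈ₚ 1ₚ
  const-1 zero = refl
  const-1 (suc n) = refl

  const-^ : ∀ x m → const x ^ₚ m ≈ₚ const (x ^ m)
  const-^ x zero = CommutativeRing.sym R[[t]] const-1
  const-^ x (suc m) = CommutativeRing.trans R[[t]]
    (*ₚ-cong {const x} {const x} (λ _ → refl) (const-^ x m)) (CommutativeRing.sym R[[t]] (const-homo-* x (x ^ m)))

  infix 4 t^_∣_
  t^_∣_ : ℕ → PS → Set ℓ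
  t^ m ∣ F = ∀ n → n ℕ.< m → F n ≈ 0#

  t^∣-cong : ∀ {m F G} → F ≈ₚ G → t^ m ∣ F → t^ m ∣ G
  t^∣-cong F≈G m∣F n n<m = trans (sym (F≈G n)) (m∣F n n<m)

  t^∣-*ʳ : ∀ {m F} G → t^ m ∣ F → t^ m ∣ F *ₚ G
  t^∣-*ʳ G m∣F n n<m =
    ∑≤-zero n (λ i i≤n → trans (*-cong (m∣F i (ℕ.≤-<-trans i≤n n<m)) refl) (zeroˡ _))

  t^∣-*ˡ : ∀ {m G} F → t^ m ∣ G → t^ m ∣ F *ₚ G
  t^∣-*ˡ {G = G} F m∣G n n<m = trans (*ₚ-comm F G n) (t^∣-*ʳ F m∣G n n<m)

  t^∣-t*ₚ : ∀ {m F} → t^ m ∣ F → t^ suc m ∣ t *ₚ F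
  t^∣-t*ₚ {F = F} m∣F zero _ = t*ₚ-zero F
  t^∣-t*ₚ {F = F} m∣F (suc n) (s≤s n<m) = trans (t*ₚ-suc F n) (m∣F n n<m)

  coeff-*ₚ-t^∣ : ∀ F {n G} → t^ n ∣ G → (F *ₚ G) n ≈ F 0 * G n
  coeff-*ₚ-t^∣ F {n} n∣G = ∑≤-first n _ (λ i 0<i i≤n →
    trans (*-cong refl (n∣G (n ∸ i) (ℕ.∸-monoʳ-< 0<i i≤n))) (zeroʳ _))

  twist : Carrier → PS → PS
  twist u F n = u ^ n * F n

  twist-cong : ∀ u {F G} → F ≈ₚ G → twist u F ≈ₚ twist u G
  twist-cong u F≈G n = *-cong refl (F≈G n)

  twist-+ : ∀ u F G → twist u (F +ₚ G) ≈ₚ twist u F +ₚ twist u G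
  twist-+ u F G n = distribˡ _ _ _

  twist-neg : ∀ u F → twist u (-ₚ F) ≈ₚ -ₚ twist u F
  twist-neg u F n = sym (-‿distribʳ-* _ _)

  twist-1 : ∀ u → twist u 1ₚ ≈ₚ 1ₚ
  twist-1 u zero = *-identityˡ _
  twist-1 u (suc n) = zeroʳ _

  twist-* : ∀ u F G → twist u (F *ₚ G) ≈ₚ twist u F *ₚ twist u G
  twist-* u F G n = trans (*-distribˡ-∑≤ n _ _) (∑≤-cong n (λ i i≤n →
    trans (*-cong (trans (reflexive (≡.cong (u ^_) (≡.sym (ℕ.m+[n∸m]≡n i≤n)))) (^-homo-* u i (n ∸ i))) refl)
          (interchange _ _ _ _)))
    where open import Algebra.Properties.CommutativeSemigroup *-commutativeSemigroup using (interchange)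

  twist-const : ∀ u x → twist u (const x) ≈ₚ const x
  twist-const u x zero = *-identityˡ _
  twist-const u x (suc n) = zeroʳ _

  twist-t : ∀ u → twist u t ≈ₚ const u *ₚ t
  twist-t u n = trans (twist-t-coeff n) (sym (const-*ₚ u t n))
    where
    twist-t-coeff : ∀ n → twist u t n ≈ u * t n
    twist-t-coeff zero = trans (zeroʳ _) (sym (zeroʳ _))
    twist-t-coeff (suc zero) = trans (*-identityʳ _) (trans (*-identityʳ _) (sym (*-identityʳ _)))
    twist-t-coeff (suc (suc n)) = trans (zeroʳ _) (sym (zeroʳ _))

  t^∣-twist : ∀ u {m F} → t^ m ∣ F → t^ m ∣ twist u F
  t^∣-twist u m∣F n n<m = trans (*-cong refl (m∣F n n<m)) (zeroʳ _)

  -- ∑ₜ T is the sum of the family T only when t^ k ∣ T k for every k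
  ∑ₜ : (ℕ → PS) → PS
  ∑ₜ T n = ∑[ k ≤ n ] T k n

  ∑ₜ-cong : ∀ {T T′} → (∀ k → T k ≈ₚ T′ k) → ∑ₜ T ≈ₚ ∑ₜ T′
  ∑ₜ-cong T≈T′ n = ∑≤-cong n (λ k _ → T≈T′ k n)

  ∑ₜ-distrib-− : ∀ (T T′ : ℕ → PS) → ∑ₜ (λ k → T k +ₚ -ₚ T′ k) ≈ₚ ∑ₜ T +ₚ -ₚ ∑ₜ T′
  ∑ₜ-distrib-− T T′ n = trans (∑≤-distrib-+ n _ _) (+-cong refl (sym (-‿distrib-∑≤ n _)))

  twist-∑ₜ : ∀ u (T : ℕ → PS) → twist u (∑ₜ T) ≈ₚ ∑ₜ (λ k → twist u (T k))
  twist-∑ₜ u T n = *-distribˡ-∑≤ n _ _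

  *ₚ-∑ₜ : ∀ F (T : ℕ → PS) → (∀ k → t^ k ∣ T k) → F *ₚ ∑ₜ T ≈ₚ ∑ₜ (λ k → F *ₚ T k)
  *ₚ-∑ₜ F T k∣T n = begin
      ∑[ i ≤ n ] (F i * ∑[ k ≤ n ∸ i ] T k (n ∸ i))
    ≈⟨ ∑≤-cong n (λ i _ → *-cong refl
         (∑≤-extend n _ (ℕ.m∸n≤m n i) (λ k n∸i<k _ → k∣T k (n ∸ i) n∸i<k))) ⟩
      ∑[ i ≤ n ] (F i * ∑[ k ≤ n ] T k (n ∸ i))
    ≈⟨ ∑≤-cong n (λ i _ → *-distribˡ-∑≤ n _ _) ⟩
      ∑[ i ≤ n ] ∑[ k ≤ n ] (F i * T k (n ∸ i))
    ≈⟨ ∑≤-swap n n _ ⟩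
      ∑[ k ≤ n ] ∑[ i ≤ n ] (F i * T k (n ∸ i))
    ∎

  ∑ₜ-telescope : ∀ (G : ℕ → PS) → G 0 ≈ₚ 0ₚ → (∀ k → t^ k ∣ G k) →
                 ∑ₜ (λ k → G (suc k) +ₚ -ₚ G k) ≈ₚ 0ₚ
  ∑ₜ-telescope G G₀≈0 k∣G n = trans (∑≤-telescope n (λ k → G k n))
    (trans (+-cong (k∣G (suc n) n ℕ.≤-refl) (-‿cong (G₀≈0 n))) (trans (+-identityˡ _) -0#≈0#))

  t-powersFixOnlyZero : PowersFixOnlyZero R[[t]] t
  t-powersFixOnlyZero {m} F 1≤m fixed = <-rec _ vanish
    where
    vanish : ∀ n → (∀ {k} → k ℕ.< n → F k ≈ 0#) → F n ≈ 0#
    vanish n ih with n ℕ.<? m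
    ... | yes n<m = trans (sym (fixed n)) (t^-*ₚ-below m F n n<m)
    ... | no n≮m = begin
        F n                          ≈⟨ reflexive (≡.cong F (≡.sym (ℕ.m+[n∸m]≡n m≤n))) ⟩
        F (m ℕ.+ (n ∸ m))            ≈⟨ sym (fixed (m ℕ.+ (n ∸ m))) ⟩
        (t ^ₚ m *ₚ F) (m ℕ.+ (n ∸ m)) ≈⟨ t^-*ₚ-shift m F (n ∸ m) ⟩
        F (n ∸ m)                    ≈⟨ ih (ℕ.∸-monoʳ-< 1≤m m≤n) ⟩
        0#                           ∎
      where m≤n = ℕ.≮⇒≥ n≮m

  const-powersFixOnlyZero : ∀ {u} → PowersFixOnlyZero R u → PowersFixOnlyZero R[[t]] (const u)
  const-powersFixOnlyZero {u} fixOnlyZero {m} F 1≤m fixed n = fixOnlyZero (F n) 1≤m (begin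
    u ^ m * F n                ≈⟨ sym (const-*ₚ (u ^ m) F n) ⟩
    (const (u ^ m) *ₚ F) n     ≈⟨ *ₚ-cong {F = const (u ^ m)} {G = F} (λ k → sym (const-^ u m k)) (λ _ → refl) n ⟩
    (const u ^ₚ m *ₚ F) n      ≈⟨ fixed n ⟩
    F n                        ∎)

  twisted-equation-unique : ∀ {u U V S} → PowersFixOnlyZero R u → U 0 ≈ 1# → V 0 ≈ 1# →
                            U *ₚ twist u S ≈ₚ V *ₚ S → S 0 ≈ 0# → S ≈ₚ 0ₚ
  twisted-equation-unique {u} {U} {V} {S} fixOnlyZero U₀≈1 V₀≈1 equation S₀≈0 = <-rec _ vanish
    where
    vanish : ∀ m → (∀ {k} → k ℕ.< m → S k ≈ 0#) → S m ≈ 0#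
    vanish zero _ = S₀≈0
    vanish (suc m) ih = fixOnlyZero {suc m} (S (suc m)) (s≤s z≤n) (begin
      u ^ suc m * S (suc m)     ≈⟨ sym (*-identityˡ _) ⟩
      1# * twist u S (suc m)    ≈⟨ *-cong (sym U₀≈1) refl ⟩
      U 0 * twist u S (suc m)   ≈⟨ sym (coeff-*ₚ-t^∣ U (t^∣-twist u below)) ⟩
      (U *ₚ twist u S) (suc m)  ≈⟨ equation (suc m) ⟩
      (V *ₚ S) (suc m)          ≈⟨ coeff-*ₚ-t^∣ V below ⟩
      V 0 * S (suc m)           ≈⟨ trans (*-cong V₀≈1 refl) (*-identityˡ _) ⟩
      S (suc m)                 ∎)
      where
      below : t^ suc m ∣ S
      below k k<1+m = ih k<1+m

module _ {c ℓ} (R : CommutativeRing c ℓ) where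
  open CommutativeRing R

  withMultiplication : (_∙_ : Carrier → Carrier → Carrier) (e : Carrier) →
                       (∀ x y → x ∙ y ≈ x * y) → e ≈ 1# → CommutativeRing c ℓ
  withMultiplication _∙_ e ∙≈* e≈1 = record
    { Carrier = Carrier ; _≈_ = _≈_ ; _+_ = _+_ ; _*_ = _∙_ ; -_ = -_ ; 0# = 0# ; 1# = e
    ; isCommutativeRing = record
      { isRing = record
        { +-isAbelianGroup = +-isAbelianGroup
        ; *-cong = λ {x} {x′} {y} {y′} x≈x′ y≈y′ →
            trans (∙≈* x y) (trans (*-cong x≈x′ y≈y′) (sym (∙≈* x′ y′)))
        ; *-assoc = λ x y z → trans (∙≈* _ z) (trans (*-cong (∙≈* x y) refl)
                      (trans (*-assoc x y z) (sym (trans (∙≈* x _) (*-cong refl (∙≈* y z))))))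
        ; *-identity = (λ x → trans (∙≈* e x) (trans (*-cong e≈1 refl) (*-identityˡ x)))
                     , (λ x → trans (∙≈* x e) (trans (*-cong refl e≈1) (*-identityʳ x)))
        ; distrib = (λ x y z → trans (∙≈* x _) (trans (distribˡ x y z) (sym (+-cong (∙≈* x y) (∙≈* x z)))))
                  , (λ x y z → trans (∙≈* _ x) (trans (distribʳ x y z) (sym (+-cong (∙≈* y x) (∙≈* z x))))) }
      ; *-comm = λ x y → trans (∙≈* x y) (trans (*-comm x y) (sym (∙≈* y x))) } }

open import Defs

ℤ-ring : CommutativeRing 0ℓ 0ℓ
ℤ-ring = ℤ.+-*-commutativeRing

-- Since F a b c is the coefficient of x^a y^b q^c, Series is literally the
-- carrier of ℤ⟦q⟧⟦y⟧⟦x⟧, and _≈_, _+s_, -s_ are its ring operations.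
module ⟦q⟧ = PowerSeries ℤ-ring
module ⟦y⟧ = PowerSeries ⟦q⟧.R[[t]]
module ⟦x⟧ = PowerSeries ⟦y⟧.R[[t]]

sumLe≡∑≤ : ∀ n f → sumLe n f ≡ FiniteSums.∑≤ ℤ-ring n f
sumLe≡∑≤ zero f = ≡.refl
sumLe≡∑≤ (suc n) f = ≡.cong (ℤ._+ f (suc n)) (sumLe≡∑≤ n f)

*s≈*ₚ : ∀ F G → F *s G ≈ F ⟦x⟧.*ₚ G
*s≈*ₚ F G a b c = ≡.trans (sumLe≡∑≤ a _)
  (≡.trans (∑≤-cong a (λ i _ → ≡.trans (sumLe≡∑≤ b _)
             (≡.trans (∑≤-cong b (λ j _ → sumLe≡∑≤ c _)) (≡.sym (⟦q⟧.∑≤ₚ-coeff b _ c)))))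
           (≡.sym (≡.trans (⟦y⟧.∑≤ₚ-coeff a _ b c) (⟦q⟧.∑≤ₚ-coeff a _ c))))
  where open FiniteSums ℤ-ring using (∑≤-cong)

1s≈1ₚ : 1s ≈ ⟦x⟧.1ₚ
1s≈1ₚ zero zero zero = ≡.refl
1s≈1ₚ zero zero (suc c) = ≡.refl
1s≈1ₚ zero (suc b) c = ≡.refl
1s≈1ₚ (suc a) b c = ≡.refl

Series-ring : CommutativeRing 0ℓ 0ℓ
Series-ring = withMultiplication ⟦x⟧.R[[t]] _*s_ 1s *s≈*ₚ 1s≈1ₚ

module S = CommutativeRing Series-ring

constS : ℤ → Series
constS z = mono z 0 0 0

const³ : ℤ → Series
const³ z = ⟦x⟧.const (⟦y⟧.const (⟦q⟧.const z))

constS≈const³ : ∀ z → constS z ≈ const³ z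
constS≈const³ z zero zero zero = ≡.refl
constS≈const³ z zero zero (suc c) = ≡.refl
constS≈const³ z zero (suc b) c = ≡.refl
constS≈const³ z (suc a) b c = ≡.refl

constS-homo-* : ∀ z w → constS (z ℤ.* w) ≈ constS z *s constS w
constS-homo-* z w = S.trans (constS≈const³ (z ℤ.* w))
  (S.trans (⟦x⟧.const-cong (⟦y⟧.const-cong (⟦q⟧.const-homo-* z w)))
  (S.trans (⟦x⟧.const-cong (⟦y⟧.const-homo-* _ _))
  (S.trans (⟦x⟧.const-homo-* _ _)
  (S.sym (S.trans (S.*-cong (constS≈const³ z) (constS≈const³ w)) (*s≈*ₚ (const³ z) (const³ w)))))))

ℤ→Series : CommutativeRing.rawRing ℤ-ring -Raw-AlmostCommutative⟶ fromCommutativeRing Series-ring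
ℤ→Series = record
  { ⟦_⟧ = constS
  ; +-homo = λ z w → origin-cases (λ a b c → constS (z ℤ.+ w) a b c ≡ (constS z +s constS w) a b c)
                       ≡.refl (λ _ → ≡.refl) (λ _ _ → ≡.refl) (λ _ _ _ → ≡.refl)
  ; *-homo = constS-homo-*
  ; -‿homo = λ z → origin-cases (λ a b c → constS (ℤ.- z) a b c ≡ (-s constS z) a b c)
                     ≡.refl (λ _ → ≡.refl) (λ _ _ → ≡.refl) (λ _ _ _ → ≡.refl)
  ; 0-homo = origin-cases (λ a b c → constS 0ℤ a b c ≡ ⟦x⟧.0ₚ a b c)
               ≡.refl (λ _ → ≡.refl) (λ _ _ → ≡.refl) (λ _ _ _ → ≡.refl)
  ; 1-homo = S.refl }
  where
  origin-cases : ∀ (P : ℕ → ℕ → ℕ → Set) → P 0 0 0 → (∀ c → P 0 0 (suc c)) →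
              (∀ b c → P 0 (suc b) c) → (∀ a b c → P (suc a) b c) → ∀ a b c → P a b c
  origin-cases P p₀ p₁ p₂ p₃ zero zero zero = p₀
  origin-cases P p₀ p₁ p₂ p₃ zero zero (suc c) = p₁ c
  origin-cases P p₀ p₁ p₂ p₃ zero (suc b) c = p₂ b c
  origin-cases P p₀ p₁ p₂ p₃ (suc a) b c = p₃ a b c

constS≟ : ∀ z w → Maybe (constS z ≈ constS w)
constS≟ z w with z ℤ.≟ w
... | yes ≡.refl = just S.refl
... | no _ = nothing

module Solver = RingSolver (CommutativeRing.rawRing ℤ-ring) (fromCommutativeRing Series-ring) ℤ→Series constS≟

infix 4 x^_∣_
x^_∣_ : ℕ → Series → Set
x^ n ∣ F = ⟦x⟧.t^ n ∣ F

x^∣-*ʳ : ∀ {n F} G → x^ n ∣ F → x^ n ∣ F *s G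
x^∣-*ʳ {F = F} G n∣F = ⟦x⟧.t^∣-cong (S.sym (*s≈*ₚ F G)) (⟦x⟧.t^∣-*ʳ G n∣F)

x^∣-*ˡ : ∀ {n G} F → x^ n ∣ G → x^ n ∣ F *s G
x^∣-*ˡ {G = G} F n∣G = ⟦x⟧.t^∣-cong (S.sym (*s≈*ₚ F G)) (⟦x⟧.t^∣-*ˡ F n∣G)

q : ⟦y⟧.PS
q = ⟦y⟧.const ⟦q⟧.t

X≈t : X ≈ ⟦x⟧.t
X≈t zero zero zero = ≡.refl
X≈t zero zero (suc c) = ≡.refl
X≈t zero (suc b) c = ≡.refl
X≈t (suc zero) zero zero = ≡.refl
X≈t (suc zero) zero (suc c) = ≡.refl
X≈t (suc zero) (suc b) c = ≡.refl
X≈t (suc (suc a)) b c = ≡.refl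

Y≈const-t : Y ≈ ⟦x⟧.const ⟦y⟧.t
Y≈const-t zero zero zero = ≡.refl
Y≈const-t zero zero (suc c) = ≡.refl
Y≈const-t zero (suc zero) zero = ≡.refl
Y≈const-t zero (suc zero) (suc c) = ≡.refl
Y≈const-t zero (suc (suc b)) c = ≡.refl
Y≈const-t (suc a) b c = ≡.refl

Q≈const-q : Q ≈ ⟦x⟧.const q
Q≈const-q zero zero zero = ≡.refl
Q≈const-q zero zero (suc zero) = ≡.refl
Q≈const-q zero zero (suc (suc c)) = ≡.refl
Q≈const-q zero (suc b) c = ≡.refl
Q≈const-q (suc a) b c = ≡.refl

x^∣-X^ : ∀ n → x^ n ∣ X ^s n
x^∣-X^ zero _ ()
x^∣-X^ (suc n) = ⟦x⟧.t^∣-cong (S.sym X*X^n≈t*X^n) (⟦x⟧.t^∣-t*ₚ (x^∣-X^ n))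
  where
  X*X^n≈t*X^n : X *s X ^s n ≈ ⟦x⟧.t ⟦x⟧.*ₚ X ^s n
  X*X^n≈t*X^n = S.trans (*s≈*ₚ X (X ^s n)) (⟦x⟧.*ₚ-cong {X} {⟦x⟧.t} {X ^s n} X≈t S.refl)

-- σ F (x, y, q) = F (x q, y, q)
σ : Series → Series
σ = ⟦x⟧.twist q

σ-cong : ∀ {F G} → F ≈ G → σ F ≈ σ G
σ-cong = ⟦x⟧.twist-cong q

σ-* : ∀ F G → σ (F *s G) ≈ σ F *s σ G
σ-* F G = S.trans (σ-cong (*s≈*ₚ F G)) (S.trans (⟦x⟧.twist-* q F G) (S.sym (*s≈*ₚ (σ F) (σ G))))

σ-- : ∀ F G → σ (F -s G) ≈ σ F -s σ G
σ-- F G = S.trans (⟦x⟧.twist-+ q F (-s G)) (S.+-cong (S.refl {σ F}) (⟦x⟧.twist-neg q G))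

σ-1 : σ 1s ≈ 1s
σ-1 = S.trans (σ-cong 1s≈1ₚ) (S.trans (⟦x⟧.twist-1 q) (S.sym 1s≈1ₚ))

σ-^ : ∀ F n → σ (F ^s n) ≈ σ F ^s n
σ-^ F zero = σ-1
σ-^ F (suc n) = S.trans (σ-* F (F ^s n)) (S.*-cong (S.refl {σ F}) (σ-^ F n))

σ-Q : σ Q ≈ Q
σ-Q = S.trans (σ-cong Q≈const-q) (S.trans (⟦x⟧.twist-const q q) (S.sym Q≈const-q))

σ-Y : σ Y ≈ Y
σ-Y = S.trans (σ-cong Y≈const-t) (S.trans (⟦x⟧.twist-const q ⟦y⟧.t) (S.sym Y≈const-t))

σ-X : σ X ≈ X *s Q
σ-X = S.trans (σ-cong X≈t) (S.trans (⟦x⟧.twist-t q) (S.trans (⟦x⟧.*ₚ-comm (⟦x⟧.const q) ⟦x⟧.t)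
        (S.sym (S.trans (*s≈*ₚ X Q) (⟦x⟧.*ₚ-cong {X} {⟦x⟧.t} {Q} X≈t Q≈const-q)))))

σ-coeff : ∀ F a b c → σ F a b c ≡ (⟦q⟧.t ⟦q⟧.^ₚ a ⟦q⟧.*ₚ F a b) c
σ-coeff F a b c =
  ≡.trans (⟦y⟧.*ₚ-cong {q ⟦y⟧.^ₚ a} {⟦y⟧.const (⟦q⟧.t ⟦q⟧.^ₚ a)} {F a}
                         (⟦y⟧.const-^ ⟦q⟧.t a) (λ _ _ → ≡.refl) b c)
          (⟦y⟧.const-*ₚ (⟦q⟧.t ⟦q⟧.^ₚ a) (F a) b c)

σ-coeff-below : ∀ F a b c → c ℕ.< a → σ F a b c ≡ 0ℤ
σ-coeff-below F a b c c<a = ≡.trans (σ-coeff F a b c) (⟦q⟧.t^-*ₚ-below a (F a b) c c<a)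

σ-coeff-shift : ∀ F a b m → σ F a b (a ℕ.+ m) ≡ F a b m
σ-coeff-shift F a b m = ≡.trans (σ-coeff F a b (a ℕ.+ m)) (⟦q⟧.t^-*ₚ-shift a (F a b) m)

open import Algebra.Properties.Semiring.Exp S.semiring using (_^_; ^-homo-*; ^-assocʳ; ^-cong)
open import Algebra.Properties.CommutativeSemiring.Exp S.commutativeSemiring using (^-distrib-*)
open import Algebra.Properties.Ring S.ring using (x[y-z]≈xy-xz; [y-z]x≈yx-zx)
open import Algebra.Properties.Group S.+-group using (x∙y⁻¹≈ε⇒x≈y)
open import Relation.Binary.Reasoning.Setoid S.setoid
open Solver using (solve; _:+_; _:*_; _:-_; :-_; _:^_; _:=_; con)

^s≈^ : ∀ F n → F ^s n ≈ F ^ n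
^s≈^ F zero = S.refl
^s≈^ F (suc n) = S.*-cong (S.refl {F}) (^s≈^ F n)

^s-cong : ∀ {F G} → F ≈ G → ∀ n → F ^s n ≈ G ^s n
^s-cong F≈G zero = S.refl
^s-cong F≈G (suc n) = S.*-cong F≈G (^s-cong F≈G n)

^s-+ : ∀ F m n → F ^s (m ℕ.+ n) ≈ F ^s m *s F ^s n
^s-+ F m n = S.trans (^s≈^ F (m ℕ.+ n))
  (S.trans (^-homo-* F m n) (S.sym (S.*-cong (^s≈^ F m) (^s≈^ F n))))

^s-* : ∀ F k n → F ^s (k ℕ.* n) ≈ (F ^s n) ^s k
^s-* F k n = S.trans (^s≈^ F (k ℕ.* n)) (S.trans (S.reflexive (≡.cong (F ^_) (ℕ.*-comm k n)))
  (S.sym (S.trans (^s≈^ (F ^s n) k) (S.trans (^-cong (^s≈^ F n) (≡.refl {x = k})) (^-assocʳ F n k)))))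

^s-distrib-*s : ∀ F G n → (F *s G) ^s n ≈ F ^s n *s G ^s n
^s-distrib-*s F G n = S.trans (^s≈^ (F *s G) n)
  (S.trans (^-distrib-* F G n) (S.sym (S.*-cong (^s≈^ F n) (^s≈^ G n))))

sumLe-zero : ∀ n f → (∀ i → i ℕ.≤ n → f i ≡ 0ℤ) → sumLe n f ≡ 0ℤ
sumLe-zero n f f≡0 = ≡.trans (sumLe≡∑≤ n f) (FiniteSums.∑≤-zero ℤ-ring n f≡0)

Additive : (ℕ → ℕ → ℕ → ℕ) → Set
Additive w = ∀ {i j k a b c} → i ℕ.≤ a → j ℕ.≤ b → k ℕ.≤ c →
             w a b c ≡ w i j k ℕ.+ w (a ∸ i) (b ∸ j) (c ∸ k)

module WeightedOrder (w : ℕ → ℕ → ℕ → ℕ) (w-additive : Additive w) where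

  record Ord≥ (n : ℕ) (F : Series) : Set where
    constructor ord≥
    field vanish : ∀ a b c → w a b c ℕ.< n → F a b c ≡ 0ℤ
  open Ord≥ public

  Ord≥-agree : ∀ {n F G} → Ord≥ n (F -s G) → ∀ a b c → w a b c ℕ.< n → F a b c ≡ G a b c
  Ord≥-agree {F = F} {G} F-G≥n a b c wt<n = ℤ.i-j≡0⇒i≡j (F a b c) (G a b c) (vanish F-G≥n a b c wt<n)

  Ord≥-cong : ∀ {n F G} → F ≈ G → Ord≥ n F → Ord≥ n G
  Ord≥-cong F≈G F≥n = ord≥ λ a b c wt<n → ≡.trans (≡.sym (F≈G a b c)) (vanish F≥n a b c wt<n)

  Ord≥-weaken : ∀ {m n F} → m ℕ.≤ n → Ord≥ n F → Ord≥ m F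
  Ord≥-weaken m≤n F≥n = ord≥ λ a b c wt<m → vanish F≥n a b c (ℕ.<-≤-trans wt<m m≤n)

  Ord≥-0 : ∀ {F} → Ord≥ 0 F
  Ord≥-0 = ord≥ λ _ _ _ ()

  Ord≥-+ : ∀ {n F G} → Ord≥ n F → Ord≥ n G → Ord≥ n (F +s G)
  Ord≥-+ F≥n G≥n = ord≥ λ a b c wt<n → ≡.cong₂ ℤ._+_ (vanish F≥n a b c wt<n) (vanish G≥n a b c wt<n)

  Ord≥-neg : ∀ {n F} → Ord≥ n F → Ord≥ n (-s F)
  Ord≥-neg F≥n = ord≥ λ a b c wt<n → ≡.cong ℤ.-_ (vanish F≥n a b c wt<n)

  -- each term F i j k * G (a-i) (b-j) (c-k) has one factor of too small weight
  Ord≥-* : ∀ {m n F G} → Ord≥ m F → Ord≥ n G → Ord≥ (m ℕ.+ n) (F *s G)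
  Ord≥-* {m} {n} {F} {G} F≥m G≥n = ord≥ λ a b c wt<m+n →
    sumLe-zero a _ λ i i≤a → sumLe-zero b _ λ j j≤b → sumLe-zero c _ λ k k≤c →
      term-vanishes (w-additive i≤a j≤b k≤c) wt<m+n
    where
    term-vanishes : ∀ {a b c i j k} → w a b c ≡ w i j k ℕ.+ w (a ∸ i) (b ∸ j) (c ∸ k) →
                    w a b c ℕ.< m ℕ.+ n →
                    F i j k ℤ.* G (a ∸ i) (b ∸ j) (c ∸ k) ≡ 0ℤ
    term-vanishes {a} {b} {c} {i} {j} {k} split wt<m+n with w i j k ℕ.<? m
    ... | yes wt<m = ≡.trans (≡.cong (ℤ._* G (a ∸ i) (b ∸ j) (c ∸ k)) (vanish F≥m i j k wt<m))
                             (ℤ.*-zeroˡ (G (a ∸ i) (b ∸ j) (c ∸ k)))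
    ... | no wt≮m = ≡.trans (≡.cong (F i j k ℤ.*_) (vanish G≥n (a ∸ i) (b ∸ j) (c ∸ k) rest<n))
                            (ℤ.*-zeroʳ (F i j k))
      where
      rest<n : w (a ∸ i) (b ∸ j) (c ∸ k) ℕ.< n
      rest<n = ℕ.+-cancelˡ-< m _ n
        (ℕ.≤-<-trans (ℕ.+-monoˡ-≤ _ (ℕ.≮⇒≥ wt≮m)) (≡.subst (ℕ._< m ℕ.+ n) split wt<m+n))

  Ord≥-*ʳ : ∀ {n F} G → Ord≥ n F → Ord≥ n (F *s G)
  Ord≥-*ʳ {n} G F≥n = Ord≥-weaken (ℕ.≤-reflexive (≡.sym (ℕ.+-identityʳ n))) (Ord≥-* F≥n (Ord≥-0 {G}))

  Ord≥-*ˡ : ∀ {n G} F → Ord≥ n G → Ord≥ n (F *s G)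
  Ord≥-*ˡ F G≥n = Ord≥-* (Ord≥-0 {F}) G≥n

  Ord≥-^ : ∀ {n F} k → Ord≥ n F → Ord≥ (k ℕ.* n) (F ^s k)
  Ord≥-^ zero F≥n = Ord≥-0
  Ord≥-^ (suc k) F≥n = Ord≥-* F≥n (Ord≥-^ k F≥n)

  Ord≥-^₁ : ∀ {F} k → Ord≥ 1 F → Ord≥ k (F ^s k)
  Ord≥-^₁ k F≥1 = Ord≥-weaken (ℕ.≤-reflexive (≡.sym (ℕ.*-identityʳ k))) (Ord≥-^ k F≥1)

q-degree : ℕ → ℕ → ℕ → ℕ
q-degree a b c = c

total-degree : ℕ → ℕ → ℕ → ℕ
total-degree a b c = a ℕ.+ b ℕ.+ c

module QOrder = WeightedOrder q-degree (λ _ _ k≤c → ≡.sym (ℕ.m+[n∸m]≡n k≤c))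

total-degree-additive : Additive total-degree
total-degree-additive {i} {j} {k} {a} {b} {c} i≤a j≤b k≤c = ≡.trans
  (≡.sym (≡.cong₂ ℕ._+_ (≡.cong₂ ℕ._+_ (ℕ.m+[n∸m]≡n i≤a) (ℕ.m+[n∸m]≡n j≤b)) (ℕ.m+[n∸m]≡n k≤c)))
  (≡.trans (≡.cong (ℕ._+ (k ℕ.+ (c ∸ k))) (interchange i (a ∸ i) j (b ∸ j)))
           (interchange (i ℕ.+ j) (a ∸ i ℕ.+ (b ∸ j)) k (c ∸ k)))
  where open import Algebra.Properties.CommutativeSemigroup ℕ.+-commutativeSemigroup using (interchange)

module DegOrder = WeightedOrder total-degree total-degree-additive

open QOrder using (ord≥; Ord≥-cong; Ord≥-weaken; Ord≥-agree)

1-cong : ∀ {F G} → F ≈ G → 1s -s F ≈ 1s -s G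
1-cong {F} {G} F≈G = S.+-congˡ {1s} (S.-‿cong {F} {G} F≈G)

Q≥1 : QOrder.Ord≥ 1 Q
Q≥1 = ord≥ vanish
  where
  vanish : ∀ a b c → c ℕ.< 1 → Q a b c ≡ 0ℤ
  vanish zero zero zero _ = ≡.refl
  vanish zero (suc b) zero _ = ≡.refl
  vanish (suc a) b zero _ = ≡.refl
  vanish a b (suc c) (s≤s ())

Q^≥ : ∀ m → QOrder.Ord≥ m (Q ^s m)
Q^≥ m = QOrder.Ord≥-^₁ m Q≥1

poch-cong : ∀ {A A′} s → A ≈ A′ → ∀ n → poch A s n ≈ poch A′ s n
poch-cong s A≈A′ zero = S.refl
poch-cong s A≈A′ (suc n) = S.*-cong (poch-cong s A≈A′ n) (1-cong (S.*-congʳ {Q ^s (s ℕ.* n)} A≈A′))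

poch-shift : ∀ A s n → poch A s (suc n) ≈ (1s -s A) *s poch (A *s Q ^s s) s n
poch-shift A s zero = begin
    1s *s (1s -s A *s Q ^s (s ℕ.* 0))
  ≈⟨ S.*-congˡ {1s} (1-cong (S.*-congˡ {A} (S.reflexive (≡.cong (Q ^s_) (ℕ.*-zeroʳ s))))) ⟩
    1s *s (1s -s A *s 1s)
  ≈⟨ solve 1 (λ a → con 1ℤ :* (con 1ℤ :- a :* con 1ℤ) := (con 1ℤ :- a) :* con 1ℤ) S.refl A ⟩
    (1s -s A) *s 1s
  ∎
poch-shift A s (suc n) = begin
    poch A s (suc n) *s (1s -s A *s Q ^s (s ℕ.* suc n))
  ≈⟨ S.*-cong (poch-shift A s n) (1-cong (S.*-congˡ {A} (S.trans (S.reflexive (≡.cong (Q ^s_) (ℕ.*-suc s n)))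
                                                              (^s-+ Q s (s ℕ.* n))))) ⟩
    (1s -s A) *s poch B s n *s (1s -s A *s (Q ^s s *s Q ^s (s ℕ.* n)))
  ≈⟨ solve 4 (λ a p u v → (con 1ℤ :- a) :* p :* (con 1ℤ :- a :* (u :* v))
                       := (con 1ℤ :- a) :* (p :* (con 1ℤ :- a :* u :* v)))
           S.refl A (poch B s n) (Q ^s s) (Q ^s (s ℕ.* n)) ⟩
    (1s -s A) *s poch B s (suc n)
  ∎
  where B = A *s Q ^s s

poch-step-ord : ∀ A s n → 1 ℕ.≤ s → QOrder.Ord≥ n (poch A s (suc n) -s poch A s n)
poch-step-ord A s n 1≤s =
  Ord≥-cong (S.sym (solve 2 (λ p u → p :* (con 1ℤ :- u) :- p := :- (p :* u))
                           S.refl (poch A s n) (A *s Q ^s (s ℕ.* n))))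
    (QOrder.Ord≥-neg (QOrder.Ord≥-*ˡ (poch A s n) (QOrder.Ord≥-*ˡ A
      (Ord≥-weaken (ℕ.≤-trans (ℕ.≤-reflexive (≡.sym (ℕ.*-identityˡ n))) (ℕ.*-monoˡ-≤ n 1≤s))
                   (Q^≥ (s ℕ.* n))))))

poch-stable : ∀ A s {m n} → 1 ℕ.≤ s → m ℕ.≤ n → QOrder.Ord≥ m (poch A s n -s poch A s m)
poch-stable A s {m} 1≤s m≤n = stable (ℕ.≤⇒≤′ m≤n)
  where
  stable : ∀ {n} → m ℕ.≤′ n → QOrder.Ord≥ m (poch A s n -s poch A s m)
  stable ℕ.≤′-refl = Ord≥-cong (S.sym (S.-‿inverseʳ (poch A s m))) (ord≥ λ _ _ _ _ → ≡.refl)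
  stable (ℕ.≤′-step {n} m≤′n) =
    Ord≥-cong (solve 3 (λ x y z → (x :- y) :+ (y :- z) := x :- z) S.refl
                 (poch A s (suc n)) (poch A s n) (poch A s m))
      (QOrder.Ord≥-+ (Ord≥-weaken (ℕ.≤′⇒≤ m≤′n) (poch-step-ord A s n 1≤s)) (stable m≤′n))

poch-coeff-stable : ∀ A s {m n} → 1 ℕ.≤ s → m ℕ.≤ n → ∀ a b c → c ℕ.< m → poch A s n a b c ≡ poch A s m a b c
poch-coeff-stable A s 1≤s m≤n = Ord≥-agree (poch-stable A s 1≤s m≤n)

pochInf-cong : ∀ {A A′} s → A ≈ A′ → pochInf A s ≈ pochInf A′ s
pochInf-cong s A≈A′ a b c = poch-cong s A≈A′ (suc c) a b c

pochInf-approx : ∀ A s n → 1 ℕ.≤ s → QOrder.Ord≥ n (pochInf A s -s poch A s n)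
pochInf-approx A s n 1≤s = ord≥ λ a b c c<n →
  ℤ.i≡j⇒i-j≡0 (≡.sym (poch-coeff-stable A s 1≤s c<n a b c ℕ.≤-refl))

pochInf-shift : ∀ A s → 1 ℕ.≤ s → pochInf A s ≈ (1s -s A) *s pochInf (A *s Q ^s s) s
pochInf-shift A s 1≤s a b c =
  ≡.trans (≡.sym (poch-coeff-stable A s 1≤s (ℕ.n≤1+n (suc c)) a b c ℕ.≤-refl))
    (≡.trans (poch-shift A s (suc c) a b c)
             (≡.sym (Ord≥-agree {F = (1s -s A) *s pochInf B s} shifted-approx a b c ℕ.≤-refl)))
  where
  B = A *s Q ^s s
  shifted-approx : QOrder.Ord≥ (suc c) ((1s -s A) *s pochInf B s -s (1s -s A) *s poch B s (suc c))
  shifted-approx = Ord≥-cong (x[y-z]≈xy-xz (1s -s A) (pochInf B s) (poch B s (suc c)))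
                             (QOrder.Ord≥-*ˡ (1s -s A) (pochInf-approx B s (suc c) 1≤s))

σ-poch : ∀ A s n → σ (poch A s n) ≈ poch (σ A) s n
σ-poch A s zero = σ-1
σ-poch A s (suc n) = S.trans (σ-* (poch A s n) (1s -s A *s Q ^s (s ℕ.* n))) (S.*-cong (σ-poch A s n)
  (S.trans (σ-- 1s (A *s Q ^s (s ℕ.* n))) (S.+-cong σ-1 (S.-‿cong (S.trans (σ-* A (Q ^s (s ℕ.* n)))
    (S.*-congˡ {σ A} (S.trans (σ-^ Q (s ℕ.* n)) (^s-cong σ-Q (s ℕ.* n)))))))))

σ-by-coeffs : ∀ {F H} → (∀ a b c → c ℕ.< a → H a b c ≡ 0ℤ) → (∀ a b m → H a b (a ℕ.+ m) ≡ F a b m) → σ F ≈ H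
σ-by-coeffs {F} {H} H-below H-shift a b c with c ℕ.<? a
... | yes c<a = ≡.trans (σ-coeff-below F a b c c<a) (≡.sym (H-below a b c c<a))
... | no c≮a = ≡.subst (λ c′ → σ F a b c′ ≡ H a b c′) (ℕ.m+[n∸m]≡n (ℕ.≮⇒≥ c≮a))
                 (≡.trans (σ-coeff-shift F a b (c ∸ a)) (≡.sym (H-shift a b (c ∸ a))))

σ-pochInf : ∀ A s → 1 ℕ.≤ s → σ (pochInf A s) ≈ pochInf (σ A) s
σ-pochInf A s 1≤s = σ-by-coeffs below shift
  where
  below : ∀ a b c → c ℕ.< a → pochInf (σ A) s a b c ≡ 0ℤ
  below a b c c<a = ≡.trans (≡.sym (σ-poch A s (suc c) a b c)) (σ-coeff-below (poch A s (suc c)) a b c c<a)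
  shift : ∀ a b m → pochInf (σ A) s a b (a ℕ.+ m) ≡ pochInf A s a b m
  shift a b m = ≡.trans (≡.sym (σ-poch A s (suc (a ℕ.+ m)) a b (a ℕ.+ m)))
    (≡.trans (σ-coeff-shift (poch A s (suc (a ℕ.+ m))) a b m)
             (poch-coeff-stable A s 1≤s (s≤s (ℕ.m≤n+m m a)) a b m ℕ.≤-refl))

-- summed coefficientwise, exactly as in the definition of inv
sumS : ℕ → (ℕ → Series) → Series
sumS N f a b c = sumLe N (λ k → f k a b c)

geometric-sum : ∀ D N → sumS N (D ^s_) *s (1s -s D) ≈ 1s -s D ^s suc N
geometric-sum D zero = solve 1 (λ d → con 1ℤ :* (con 1ℤ :- d) := con 1ℤ :- d :* con 1ℤ) S.refl D
geometric-sum D (suc N) = begin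
    (G +s D ^s suc N) *s (1s -s D)
  ≈⟨ solve 3 (λ g e d → (g :+ e) :* (con 1ℤ :- d) := g :* (con 1ℤ :- d) :+ (e :- d :* e))
             S.refl G (D ^s suc N) D ⟩
    G *s (1s -s D) +s (D ^s suc N -s D *s D ^s suc N)
  ≈⟨ S.+-congʳ (geometric-sum D N) ⟩
    1s -s D ^s suc N +s (D ^s suc N -s D *s D ^s suc N)
  ≈⟨ solve 2 (λ e d → (con 1ℤ :- e) :+ (e :- d :* e) := con 1ℤ :- d :* e) S.refl (D ^s suc N) D ⟩
    1s -s D ^s suc (suc N)
  ∎
  where G = sumS N (D ^s_)

-- with D = 1 - P, the sum defining inv P agrees with the geometric series Σ_{k ≤ N} D^k in degrees ≤ N
inv-* : ∀ P → P 0 0 0 ≡ 1ℤ → inv P *s P ≈ 1s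
inv-* P P₀≡1 a b c =
  ≡.trans (DegOrder.Ord≥-agree {F = inv P *s P} close a b c ℕ.≤-refl)
 (≡.trans (S.*-congˡ {G} (solve 1 (λ p → p := con 1ℤ :- (con 1ℤ :- p)) S.refl P) a b c)
 (≡.trans (geometric-sum D N a b c)
 (≡.trans (≡.cong (λ z → 1s a b c ℤ.+ ℤ.- z) (DegOrder.vanish (DegOrder.Ord≥-^₁ (suc N) D≥1) a b c ℕ.≤-refl))
          (ℤ.+-identityʳ (1s a b c)))))
  where
  D = 1s -s P
  N = total-degree a b c
  G = sumS N (D ^s_)
  D≥1 : DegOrder.Ord≥ 1 D
  D≥1 = DegOrder.ord≥ vanish
    where
    vanish : ∀ a b c → total-degree a b c ℕ.< 1 → D a b c ≡ 0ℤ
    vanish zero zero zero _ rewrite P₀≡1 = ≡.refl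
    vanish zero zero (suc c) (s≤s ())
    vanish zero (suc b) c (s≤s ())
    vanish (suc a) b c (s≤s ())
  inv≈G : DegOrder.Ord≥ (suc N) (inv P -s G)
  inv≈G = DegOrder.ord≥ λ i j k deg<1+N → ℤ.i≡j⇒i-j≡0 (≡.trans
    (≡.trans (sumLe≡∑≤ (total-degree i j k) (coeff i j k))
             (∑≤-extend N (coeff i j k) (ℕ.≤-pred deg<1+N) (λ m deg<m _ →
                DegOrder.vanish (DegOrder.Ord≥-^₁ m D≥1) i j k deg<m)))
    (≡.sym (sumLe≡∑≤ N (coeff i j k))))
    where
    open FiniteSums ℤ-ring using (∑≤-extend)
    coeff : ℕ → ℕ → ℕ → ℕ → ℤ
    coeff i j k m = (D ^s m) i j k
  close : DegOrder.Ord≥ (suc N) (inv P *s P -s G *s P)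
  close = DegOrder.Ord≥-cong ([y-z]x≈yx-zx P (inv P) G) (DegOrder.Ord≥-*ʳ P inv≈G)

inv-unique : ∀ {K P} → P 0 0 0 ≡ 1ℤ → K *s P ≈ 1s → inv P ≈ K
inv-unique {K} {P} P₀≡1 K*P≈1 = begin
  inv P               ≈⟨ S.sym (S.*-identityʳ (inv P)) ⟩
  inv P *s 1s         ≈⟨ S.*-congˡ {inv P} (S.sym K*P≈1) ⟩
  inv P *s (K *s P)   ≈⟨ solve 3 (λ i k p → i :* (k :* p) := k :* (i :* p)) S.refl (inv P) K P ⟩
  K *s (inv P *s P)   ≈⟨ S.*-congˡ {K} (inv-* P P₀≡1) ⟩
  K *s 1s             ≈⟨ S.*-identityʳ K ⟩
  K                   ∎

inv-cong : ∀ {P P′} → P ≈ P′ → P 0 0 0 ≡ 1ℤ → inv P ≈ inv P′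
inv-cong {P} {P′} P≈P′ P₀≡1 =
  inv-unique P₀≡1 (S.trans (S.*-congˡ {inv P′} P≈P′) (inv-* P′ (≡.trans (≡.sym (P≈P′ 0 0 0)) P₀≡1)))

σ-inv : ∀ P → P 0 0 0 ≡ 1ℤ → σ (inv P) ≈ inv (σ P)
σ-inv P P₀≡1 = S.sym (inv-unique (≡.trans (σ-coeff-shift P 0 0 0) P₀≡1)
  (S.trans (S.sym (σ-* (inv P) P)) (S.trans (σ-cong (inv-* P P₀≡1)) σ-1)))

poch-constant-term : ∀ A s n → A 0 0 0 ≡ 0ℤ → poch A s n 0 0 0 ≡ 1ℤ
poch-constant-term A s zero A₀≡0 = ≡.refl
poch-constant-term A s (suc n) A₀≡0 rewrite poch-constant-term A s n A₀≡0 | A₀≡0 = ≡.refl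

x²yq² : Series
x²yq² = X ^s 2 *s Y *s Q ^s 2

U V : Series
U = (1s +s X) *s (1s -s X *s Y)
V = 1s -s x²yq²

QDifferenceEq : Series → Set
QDifferenceEq F = U *s σ F ≈ V *s F

σ-x²yq² : σ x²yq² ≈ x²yq² *s Q ^s 2
σ-x²yq² = S.trans (σ-* (X ^s 2 *s Y) (Q ^s 2))
  (S.trans (S.*-cong (S.trans (σ-* (X ^s 2) Y) (S.*-cong (S.trans (σ-^ X 2) (^s-cong σ-X 2)) σ-Y))
                     (S.trans (σ-^ Q 2) (^s-cong σ-Q 2)))
    (solve 3 (λ x y q → (x :* q) :^ 2 :* y :* q :^ 2 := x :^ 2 :* y :* q :^ 2 :* q :^ 2) S.refl X Y Q))

σ-xy : σ (X *s Y) ≈ X *s Y *s Q ^s 1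
σ-xy = S.trans (σ-* X Y) (S.trans (S.*-cong σ-X σ-Y)
  (solve 3 (λ x y q → x :* q :* y := x :* y :* q :^ 1) S.refl X Y Q))

σ-neg-x : σ (-s X) ≈ -s X *s Q ^s 1
σ-neg-x = S.trans (⟦x⟧.twist-neg q X) (S.trans (S.-‿cong σ-X)
  (solve 2 (λ x q → :- (x :* q) := (:- x) :* q :^ 1) S.refl X Q))

pochInf-σ : ∀ A s → 1 ℕ.≤ s → σ A ≈ A *s Q ^s s → pochInf A s ≈ (1s -s A) *s σ (pochInf A s)
pochInf-σ A s 1≤s σA≈AQˢ = S.trans (pochInf-shift A s 1≤s)
  (S.*-congˡ {1s -s A} (S.sym (S.trans (σ-pochInf A s 1≤s) (pochInf-cong s σA≈AQˢ))))

LHS-equation : QDifferenceEq LHS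
LHS-equation = begin
    U *s σ (P₁ *s P₂ *s inv P₃)
  ≈⟨ S.*-congˡ {U} (S.trans (σ-* (P₁ *s P₂) (inv P₃))
                             (S.*-cong (σ-* P₁ P₂) (S.trans (σ-inv P₃ ≡.refl) σ-inv-P₃))) ⟩
    U *s (σ P₁ *s σ P₂ *s (inv P₃ *s V))
  ≈⟨ solve 6 (λ x y t₁ t₂ i v → (con 1ℤ :+ x) :* (con 1ℤ :- x :* y) :* (t₁ :* t₂ :* (i :* v))
                             := v :* ((con 1ℤ :- :- x) :* t₁ :* ((con 1ℤ :- x :* y) :* t₂) :* i))
           S.refl X Y (σ P₁) (σ P₂) (inv P₃) V ⟩
    V *s ((1s -s -s X) *s σ P₁ *s ((1s -s X *s Y) *s σ P₂) *s inv P₃)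
  ≈⟨ S.*-congˡ {V} (S.*-congʳ {inv P₃} (S.sym (S.*-cong P₁-shift P₂-shift))) ⟩
    V *s (P₁ *s P₂ *s inv P₃)
  ∎
  where
  P₁ P₂ P₃ : Series
  P₁ = pochInf (-s X) 1
  P₂ = pochInf (X *s Y) 1
  P₃ = pochInf x²yq² 2
  P₁-shift : P₁ ≈ (1s -s -s X) *s σ P₁
  P₁-shift = pochInf-σ (-s X) 1 (s≤s z≤n) σ-neg-x
  P₂-shift : P₂ ≈ (1s -s X *s Y) *s σ P₂
  P₂-shift = pochInf-σ (X *s Y) 1 (s≤s z≤n) σ-xy
  σ-inv-P₃ : inv (σ P₃) ≈ inv P₃ *s V
  σ-inv-P₃ = inv-unique (σ-coeff-shift P₃ 0 0 0)
    (S.trans (S.*-assoc (inv P₃) V (σ P₃))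
      (S.trans (S.*-congˡ {inv P₃} (S.sym (pochInf-σ x²yq² 2 (s≤s z≤n) σ-x²yq²))) (inv-* P₃ ≡.refl)))

xy-poch y-poch q-poch x²yq²-poch : ℕ → Series
xy-poch = poch (X *s Y) 1
y-poch = poch Y 2
q-poch = poch Q 1
x²yq²-poch = poch x²yq² 2

denominator : ℕ → Series
denominator n = inv (q-poch n *s x²yq²-poch n)

denominator-constant-term : ∀ n {A} → A 0 0 0 ≡ 0ℤ → (q-poch n *s poch A 2 n) 0 0 0 ≡ 1ℤ
denominator-constant-term n A₀≡0 =
  ≡.cong₂ ℤ._*_ (poch-constant-term Q 1 n ≡.refl) (poch-constant-term _ 2 n A₀≡0)

partner : ℕ → Series
partner n = V *s X ^s n *s Q ^s (n C 2) *s (1s +s X *s Y *s Q ^s (2 ℕ.* n)) *s (1s -s Q ^s n)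
            *s xy-poch n *s y-poch n *s denominator n

σ-term : ∀ n → σ (term n) ≈ X ^s n *s Q ^s n *s Q ^s (n C 2) *s (1s -s (X *s Q) ^s 2 *s Y ^s 2 *s Q ^s (4 ℕ.* n))
                          *s poch (X *s Y *s Q ^s 1) 1 n *s y-poch n
                          *s inv (q-poch n *s poch (x²yq² *s Q ^s 2) 2 n)
σ-term n =
  S.trans (σ-* (xⁿ *s qᶜ *s w *s xy-poch n *s y-poch n) (denominator n)) (S.*-cong
  (S.trans (σ-* (xⁿ *s qᶜ *s w *s xy-poch n) (y-poch n)) (S.*-cong
  (S.trans (σ-* (xⁿ *s qᶜ *s w) (xy-poch n)) (S.*-cong
  (S.trans (σ-* (xⁿ *s qᶜ) w) (S.*-cong
  (S.trans (σ-* xⁿ qᶜ) (S.*-cong σ-xⁿ σ-qᶜ)) σ-w)) σ-xy-poch)) σ-y-poch)) σ-denominator)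
  where
  xⁿ = X ^s n
  qᶜ = Q ^s (n C 2)
  w = 1s -s X ^s 2 *s Y ^s 2 *s Q ^s (4 ℕ.* n)
  σ-xⁿ : σ xⁿ ≈ xⁿ *s Q ^s n
  σ-xⁿ = S.trans (σ-^ X n) (S.trans (^s-cong σ-X n) (^s-distrib-*s X Q n))
  σ-qᶜ : σ qᶜ ≈ qᶜ
  σ-qᶜ = S.trans (σ-^ Q (n C 2)) (^s-cong σ-Q (n C 2))
  σ-w : σ w ≈ 1s -s (X *s Q) ^s 2 *s Y ^s 2 *s Q ^s (4 ℕ.* n)
  σ-w = S.trans (σ-- 1s (X ^s 2 *s Y ^s 2 *s Q ^s (4 ℕ.* n))) (S.+-cong σ-1 (S.-‿cong
      (S.trans (σ-* (X ^s 2 *s Y ^s 2) (Q ^s (4 ℕ.* n))) (S.*-cong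
          (S.trans (σ-* (X ^s 2) (Y ^s 2))
                   (S.*-cong (S.trans (σ-^ X 2) (^s-cong σ-X 2)) (S.trans (σ-^ Y 2) (^s-cong σ-Y 2))))
          (S.trans (σ-^ Q (4 ℕ.* n)) (^s-cong σ-Q (4 ℕ.* n)))))))
  σ-xy-poch : σ (xy-poch n) ≈ poch (X *s Y *s Q ^s 1) 1 n
  σ-xy-poch = S.trans (σ-poch (X *s Y) 1 n) (poch-cong 1 σ-xy n)
  σ-y-poch : σ (y-poch n) ≈ y-poch n
  σ-y-poch = S.trans (σ-poch Y 2 n) (poch-cong 2 σ-Y n)
  σ-denominator : σ (denominator n) ≈ inv (q-poch n *s poch (x²yq² *s Q ^s 2) 2 n)
  σ-denominator = S.trans (σ-inv (q-poch n *s x²yq²-poch n) (denominator-constant-term n ≡.refl))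
    (inv-cong (S.trans (σ-* (q-poch n) (x²yq²-poch n))
                (S.*-cong (S.trans (σ-poch Q 1 n) (poch-cong 1 σ-Q n))
                          (S.trans (σ-poch x²yq² 2 n) (poch-cong 2 σ-x²yq² n))))
              (≡.trans (σ-coeff-shift (q-poch n *s x²yq²-poch n) 0 0 0) (denominator-constant-term n ≡.refl)))

-- instantiated with a = xy, p = q^{n+1}, z = q^n, this is the n-th telescoping step
-- divided by the common factor TermStep.K
telescoping-core : ∀ x a p z →
  (1s +s x) *s (z *s (1s -s a ^s 2 *s p ^s 2 *s z ^s 2) *s (1s -s a *s z))
    -s (1s -s a ^s 2 *s z ^s 4) *s (1s -s x *s a *s p ^s 2)
  ≈ z *s (1s +s a *s p ^s 2) *s (1s -s a *s z) *s (x -s a *s z ^s 2)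
    -s (1s +s a *s z ^s 2) *s (1s -s z) *s (1s -s x *s a *s p ^s 2)
telescoping-core = solve 4 (λ x a p z → let o = con 1ℤ in
  (o :+ x) :* (z :* (o :- a :^ 2 :* p :^ 2 :* z :^ 2) :* (o :- a :* z))
    :- (o :- a :^ 2 :* z :^ 4) :* (o :- x :* a :* p :^ 2)
  := z :* (o :+ a :* p :^ 2) :* (o :- a :* z) :* (x :- a :* z :^ 2)
    :- (o :+ a :* z :^ 2) :* (o :- z) :* (o :- x :* a :* p :^ 2)) S.refl

module TermStep (n : ℕ) where
  z xⁿ qᶜ a b d⁺ xy qz g f h w₀ w₁ : Series
  z = Q ^s n
  xⁿ = X ^s n
  qᶜ = Q ^s (n C 2)
  a = xy-poch n
  b = y-poch n
  d⁺ = denominator (suc n)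
  xy = X *s Y
  qz = Q *s z
  g = 1s -s Q *s z
  f = 1s -s xy *s z
  h = 1s -s X *s xy *s qz ^s 2
  w₀ = 1s -s xy ^s 2 *s z ^s 4
  w₁ = 1s -s xy ^s 2 *s qz ^s 2 *s z ^s 2

  Q^n≈z : Q ^s (1 ℕ.* n) ≈ z
  Q^n≈z = S.reflexive (≡.cong (Q ^s_) (ℕ.*-identityˡ n))

  Q^[2n]≈z² : Q ^s (2 ℕ.* n) ≈ z ^s 2
  Q^[2n]≈z² = ^s-* Q 2 n

  Q^[4n]≈z⁴ : Q ^s (4 ℕ.* n) ≈ z ^s 4
  Q^[4n]≈z⁴ = ^s-* Q 4 n

  q^C[n+1]≈zqᶜ : Q ^s (suc n C 2) ≈ z *s qᶜ
  q^C[n+1]≈zqᶜ = S.trans (S.reflexive (≡.cong (Q ^s_) (≡.sym (nCk+nC[k+1]≡[n+1]C[k+1] n 1))))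
    (S.trans (^s-+ Q (n C 1) (n C 2)) (S.*-congʳ {qᶜ} (S.reflexive (≡.cong (Q ^s_) (nC1≡n n)))))

  x²yq²-Q^[2n] : x²yq² *s Q ^s (2 ℕ.* n) ≈ X *s xy *s qz ^s 2
  x²yq²-Q^[2n] = S.trans (S.*-congˡ {x²yq²} Q^[2n]≈z²)
    (solve 4 (λ x y q z → x :^ 2 :* y :* q :^ 2 :* z :^ 2 := x :* (x :* y) :* (q :* z) :^ 2) S.refl X Y Q z)

  xy-poch-shift : (1s -s X *s Y) *s poch (X *s Y *s Q ^s 1) 1 n ≈ a *s f
  xy-poch-shift = S.trans (S.sym (poch-shift (X *s Y) 1 n)) (S.*-congˡ {a} (1-cong (S.*-congˡ {X *s Y} Q^n≈z)))

  d⁺-inverse : d⁺ *s (q-poch (suc n) *s x²yq²-poch (suc n)) ≈ 1s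
  d⁺-inverse = inv-* (q-poch (suc n) *s x²yq²-poch (suc n)) (denominator-constant-term (suc n) ≡.refl)

  q-poch-suc : q-poch n *s g ≈ q-poch (suc n)
  q-poch-suc = S.*-congˡ {q-poch n} (1-cong (S.*-congˡ {Q} (S.sym Q^n≈z)))

  denominator≈ : denominator n ≈ d⁺ *s g *s h
  denominator≈ = inv-unique (denominator-constant-term n ≡.refl) (S.trans
    (solve 5 (λ d g h c e → d :* g :* h :* (c :* e) := d :* (c :* g :* (e :* h))) S.refl
       d⁺ g h (q-poch n) (x²yq²-poch n))
    (S.trans (S.*-congˡ {d⁺} (S.*-cong q-poch-suc (S.*-congˡ {x²yq²-poch n} (1-cong (S.sym x²yq²-Q^[2n])))))
             d⁺-inverse))

  σ-denominator≈ : inv (q-poch n *s poch (x²yq² *s Q ^s 2) 2 n) ≈ d⁺ *s g *s V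
  σ-denominator≈ = inv-unique (denominator-constant-term n ≡.refl) (S.trans
    (solve 5 (λ d g v c e → d :* g :* v :* (c :* e) := d :* (c :* g :* (v :* e))) S.refl
       d⁺ g V (q-poch n) (poch (x²yq² *s Q ^s 2) 2 n))
    (S.trans (S.*-congˡ {d⁺} (S.*-cong q-poch-suc (S.sym (poch-shift x²yq² 2 n))))
             d⁺-inverse))

  term≈ : term n ≈ xⁿ *s qᶜ *s w₀ *s a *s b *s (d⁺ *s g *s h)
  term≈ = S.*-cong (S.*-congʳ {b} (S.*-congʳ {a} (S.*-congˡ {xⁿ *s qᶜ} (1-cong
            (S.trans (S.*-congˡ {X ^s 2 *s Y ^s 2} Q^[4n]≈z⁴)
                     (solve 3 (λ x y z → x :^ 2 :* y :^ 2 :* z :^ 4 := (x :* y) :^ 2 :* z :^ 4) S.refl X Y z))))))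
          denominator≈

  σ-term≈ : σ (term n) ≈ xⁿ *s z *s qᶜ *s w₁ *s poch (X *s Y *s Q ^s 1) 1 n *s b *s (d⁺ *s g *s V)
  σ-term≈ = S.trans (σ-term n)
    (S.*-cong (S.*-congʳ {b} (S.*-congʳ {poch (X *s Y *s Q ^s 1) 1 n} (S.*-congˡ {xⁿ *s z *s qᶜ} (1-cong
      (S.trans (S.*-congˡ {(X *s Q) ^s 2 *s Y ^s 2} Q^[4n]≈z⁴)
               (solve 4 (λ x y q z → (x :* q) :^ 2 :* y :^ 2 :* z :^ 4 := (x :* y) :^ 2 :* (q :* z) :^ 2 :* z :^ 2)
                  S.refl X Y Q z))))))
      σ-denominator≈)

  partner≈ : partner n ≈ V *s xⁿ *s qᶜ *s (1s +s xy *s z ^s 2) *s (1s -s z) *s a *s b *s (d⁺ *s g *s h)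
  partner≈ = S.*-cong (S.*-congʳ {b} (S.*-congʳ {a} (S.*-congʳ {1s -s z} (S.*-congˡ {V *s xⁿ *s qᶜ}
               (S.+-congˡ {1s} (S.*-congˡ {X *s Y} Q^[2n]≈z²))))))
             denominator≈

  partner⁺≈ : partner (suc n) ≈ V *s (X *s xⁿ) *s (z *s qᶜ) *s (1s +s xy *s qz ^s 2) *s g
                                *s (a *s f) *s (b *s (1s -s Y *s z ^s 2)) *s d⁺
  partner⁺≈ = S.*-congʳ {d⁺} (S.*-cong (S.*-cong (S.*-congʳ {g} (S.*-cong (S.*-congˡ {V *s (X *s xⁿ)} q^C[n+1]≈zqᶜ)
      (S.+-congˡ {1s} (S.*-congˡ {X *s Y} (^s-* Q 2 (suc n))))))
      (S.*-congˡ {a} (1-cong (S.*-congˡ {X *s Y} Q^n≈z))))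
      (S.*-congˡ {b} (1-cong (S.*-congˡ {Y} Q^[2n]≈z²))))

  K p₁ p₂ p₃ p₄ : Series
  K = V *s xⁿ *s qᶜ *s a *s b *s d⁺ *s g
  p₁ = (1s +s X) *s (z *s w₁ *s f)
  p₂ = w₀ *s h
  p₃ = z *s (1s +s xy *s qz ^s 2) *s f *s (X -s xy *s z ^s 2)
  p₄ = (1s +s xy *s z ^s 2) *s (1s -s z) *s h

  σ-side : U *s σ (term n) ≈ K *s p₁
  σ-side = begin
      U *s σ (term n)
    ≈⟨ S.*-congˡ {U} σ-term≈ ⟩
      U *s (xⁿ *s z *s qᶜ *s w₁ *s a′ *s b *s (d⁺ *s g *s V))
    ≈⟨ solve 11 (λ s₁ s₂ m z c w a′ b d g v → s₁ :* s₂ :* (m :* z :* c :* w :* a′ :* b :* (d :* g :* v))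
                                            := s₁ :* (s₂ :* a′) :* (m :* z :* c :* w :* b :* d :* g :* v))
             S.refl (1s +s X) (1s -s X *s Y) xⁿ z qᶜ w₁ a′ b d⁺ g V ⟩
      (1s +s X) *s ((1s -s X *s Y) *s a′) *s (xⁿ *s z *s qᶜ *s w₁ *s b *s d⁺ *s g *s V)
    ≈⟨ S.*-congʳ {xⁿ *s z *s qᶜ *s w₁ *s b *s d⁺ *s g *s V} (S.*-congˡ {1s +s X} xy-poch-shift) ⟩
      (1s +s X) *s (a *s f) *s (xⁿ *s z *s qᶜ *s w₁ *s b *s d⁺ *s g *s V)
    ≈⟨ solve 11 (λ s₁ a f m z c w b d g v → s₁ :* (a :* f) :* (m :* z :* c :* w :* b :* d :* g :* v)
                                         := v :* m :* c :* a :* b :* d :* g :* (s₁ :* (z :* w :* f)))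
             S.refl (1s +s X) a f xⁿ z qᶜ w₁ b d⁺ g V ⟩
      K *s p₁
    ∎
    where a′ = poch (X *s Y *s Q ^s 1) 1 n

  side : V *s term n ≈ K *s p₂
  side = S.trans (S.*-congˡ {V} term≈)
    (solve 9 (λ v m c w a b d g h → v :* (m :* c :* w :* a :* b :* (d :* g :* h))
                                 := v :* m :* c :* a :* b :* d :* g :* (w :* h))
       S.refl V xⁿ qᶜ w₀ a b d⁺ g h)

  partner⁺-side : partner (suc n) ≈ K *s p₃
  partner⁺-side = S.trans partner⁺≈ (S.trans
    (solve 12 (λ v x m z c e g a f b k d → v :* (x :* m) :* (z :* c) :* e :* g :* (a :* f) :* (b :* k) :* d
                                        := v :* m :* c :* a :* b :* d :* g :* (z :* e :* f :* (x :* k)))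
       S.refl V X xⁿ z qᶜ (1s +s xy *s qz ^s 2) g a f b (1s -s Y *s z ^s 2) d⁺)
    (S.*-congˡ {K} (S.*-congˡ {z *s (1s +s xy *s qz ^s 2) *s f}
       (solve 3 (λ x y z → x :* (con 1ℤ :- y :* z :^ 2) := x :- x :* y :* z :^ 2) S.refl X Y z))))

  partner-side : partner n ≈ K *s p₄
  partner-side = S.trans partner≈
    (solve 10 (λ v m c e z a b d g h → v :* m :* c :* e :* z :* a :* b :* (d :* g :* h)
                                    := v :* m :* c :* a :* b :* d :* g :* (e :* z :* h))
       S.refl V xⁿ qᶜ (1s +s xy *s z ^s 2) (1s -s z) a b d⁺ g h)

  term-step : U *s σ (term n) -s V *s term n ≈ partner (suc n) -s partner n
  term-step =
    S.trans (S.+-cong σ-side (S.-‿cong side))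
   (S.trans (S.sym (x[y-z]≈xy-xz K p₁ p₂))
   (S.trans (S.*-congˡ {K} (telescoping-core X xy qz z))
   (S.trans (x[y-z]≈xy-xz K p₃ p₄)
            (S.sym (S.+-cong partner⁺-side (S.-‿cong partner-side))))))

sumX≈∑ₜ : ∀ T → sumX T ≈ ⟦x⟧.∑ₜ T
sumX≈∑ₜ T a b c = ≡.trans (sumLe≡∑≤ a _)
  (≡.sym (≡.trans (⟦y⟧.∑≤ₚ-coeff a (λ k → T k a) b c) (⟦q⟧.∑≤ₚ-coeff a (λ k → T k a b) c)))

*s-∑ₜ : ∀ F T → (∀ k → x^ k ∣ T k) → F *s ⟦x⟧.∑ₜ T ≈ ⟦x⟧.∑ₜ (λ k → F *s T k)
*s-∑ₜ F T k∣T = S.trans (*s≈*ₚ F (⟦x⟧.∑ₜ T))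
  (S.trans (⟦x⟧.*ₚ-∑ₜ F T k∣T) (⟦x⟧.∑ₜ-cong (λ k → S.sym (*s≈*ₚ F (T k)))))

x^∣-term : ∀ n → x^ n ∣ term n
x^∣-term n = x^∣-*ʳ (denominator n) (x^∣-*ʳ (y-poch n) (x^∣-*ʳ (xy-poch n)
  (x^∣-*ʳ (1s -s X ^s 2 *s Y ^s 2 *s Q ^s (4 ℕ.* n)) (x^∣-*ʳ (Q ^s (n C 2)) (x^∣-X^ n)))))

x^∣-partner : ∀ n → x^ n ∣ partner n
x^∣-partner n = x^∣-*ʳ (denominator n) (x^∣-*ʳ (y-poch n) (x^∣-*ʳ (xy-poch n) (x^∣-*ʳ (1s -s Q ^s n)
  (x^∣-*ʳ (1s +s X *s Y *s Q ^s (2 ℕ.* n)) (x^∣-*ʳ (Q ^s (n C 2)) (x^∣-*ˡ V (x^∣-X^ n)))))))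

partner-zero : partner 0 ≈ S.0#
partner-zero = S.trans
  (solve 7 (λ v m c e a b d → v :* m :* c :* e :* (con 1ℤ :- con 1ℤ) :* a :* b :* d := v :- v) S.refl
     V (X ^s 0) (Q ^s (0 C 2)) (1s +s X *s Y *s Q ^s (2 ℕ.* 0)) (xy-poch 0) (y-poch 0) (denominator 0))
  (S.-‿inverseʳ V)

RHS-equation : QDifferenceEq RHS
RHS-equation = x∙y⁻¹≈ε⇒x≈y (U *s σ RHS) (V *s RHS) (begin
    U *s σ RHS -s V *s RHS
  ≈⟨ S.+-cong (S.*-congˡ {U} (S.trans (σ-cong (sumX≈∑ₜ term)) (⟦x⟧.twist-∑ₜ q term)))
              (S.-‿cong (S.*-congˡ {V} (sumX≈∑ₜ term))) ⟩
    U *s ⟦x⟧.∑ₜ (λ k → σ (term k)) -s V *s ⟦x⟧.∑ₜ term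
  ≈⟨ S.+-cong (*s-∑ₜ U (λ k → σ (term k)) (λ k → ⟦x⟧.t^∣-twist q (x^∣-term k)))
              (S.-‿cong (*s-∑ₜ V term x^∣-term)) ⟩
    ⟦x⟧.∑ₜ (λ k → U *s σ (term k)) -s ⟦x⟧.∑ₜ (λ k → V *s term k)
  ≈⟨ S.sym (⟦x⟧.∑ₜ-distrib-− (λ k → U *s σ (term k)) (λ k → V *s term k)) ⟩
    ⟦x⟧.∑ₜ (λ k → U *s σ (term k) -s V *s term k)
  ≈⟨ ⟦x⟧.∑ₜ-cong (λ k → TermStep.term-step k) ⟩
    ⟦x⟧.∑ₜ (λ k → partner (suc k) -s partner k)
  ≈⟨ ⟦x⟧.∑ₜ-telescope partner partner-zero x^∣-partner ⟩
    S.0#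
  ∎)

module Y = CommutativeRing ⟦y⟧.R[[t]]

record OneAtX⁰ (F : Series) : Set where
  constructor one-at-x⁰
  field x⁰-coeff : F 0 Y.≈ Y.1#
open OneAtX⁰

one-1s : OneAtX⁰ 1s
one-1s = one-at-x⁰ (1s≈1ₚ 0)

one-* : ∀ {F G} → OneAtX⁰ F → OneAtX⁰ G → OneAtX⁰ (F *s G)
one-* {F} {G} (one-at-x⁰ F₀≈1) (one-at-x⁰ G₀≈1) =
  one-at-x⁰ (Y.trans (*s≈*ₚ F G 0) (Y.trans (Y.*-cong F₀≈1 G₀≈1) (Y.*-identityˡ Y.1#)))

one-+ : ∀ {F} → x^ 1 ∣ F → OneAtX⁰ (1s +s F)
one-+ x∣F = one-at-x⁰ (Y.trans (Y.+-cong (1s≈1ₚ 0) (x∣F 0 (s≤s z≤n))) (Y.+-identityʳ Y.1#))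

one-- : ∀ {F} → x^ 1 ∣ F → OneAtX⁰ (1s -s F)
one-- x∣F = one-at-x⁰
  (Y.trans (Y.+-cong (1s≈1ₚ 0) (Y.trans (Y.-‿cong (x∣F 0 (s≤s z≤n))) -0#≈0#)) (Y.+-identityʳ Y.1#))
  where open import Algebra.Properties.Ring Y.ring using (-0#≈0#)

x∣-difference : ∀ {F G} → OneAtX⁰ F → OneAtX⁰ G → x^ 1 ∣ F -s G
x∣-difference (one-at-x⁰ F₀≈1) (one-at-x⁰ G₀≈1) zero _ =
  Y.trans (Y.+-cong F₀≈1 (Y.-‿cong G₀≈1)) (Y.-‿inverseʳ Y.1#)
x∣-difference _ _ (suc n) (s≤s ())

one-poch : ∀ {A} s n → x^ 1 ∣ A → OneAtX⁰ (poch A s n)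
one-poch s zero x∣A = one-1s
one-poch s (suc n) x∣A = one-* (one-poch s n x∣A) (one-- (x^∣-*ʳ (Q ^s (s ℕ.* n)) x∣A))

one-pochInf : ∀ {A} s → x^ 1 ∣ A → OneAtX⁰ (pochInf A s)
one-pochInf s x∣A = one-at-x⁰ λ b c → x⁰-coeff (one-poch s (suc c) x∣A) b c

one-inv : ∀ {P} → OneAtX⁰ P → OneAtX⁰ (inv P)
one-inv {P} (one-at-x⁰ P₀≈1) = one-at-x⁰ (Y.trans (Y.sym (Y.*-identityʳ (inv P 0)))
  (Y.trans (Y.*-congˡ {inv P 0} (Y.sym P₀≈1))
  (Y.trans (Y.sym (*s≈*ₚ (inv P) P 0)) (Y.trans (inv-* P (P₀≈1 0 0) 0) (1s≈1ₚ 0)))))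

x^1∣X : x^ 1 ∣ X
x^1∣X zero _ = X≈t 0
x^1∣X (suc n) (s≤s ())

x^1∣-X : x^ 1 ∣ -s X
x^1∣-X zero _ b c = ≡.cong ℤ.-_ (X≈t 0 b c)
x^1∣-X (suc n) (s≤s ())

x^1∣x²yq² : x^ 1 ∣ x²yq²
x^1∣x²yq² = x^∣-*ʳ (Q ^s 2) (x^∣-*ʳ Y (x^∣-*ʳ (X *s 1s) x^1∣X))

one-U : OneAtX⁰ U
one-U = one-* (one-+ x^1∣X) (one-- (x^∣-*ʳ Y x^1∣X))

one-V : OneAtX⁰ V
one-V = one-- x^1∣x²yq²

one-LHS : OneAtX⁰ LHS
one-LHS = one-* (one-* (one-pochInf 1 x^1∣-X) (one-pochInf 1 (x^∣-*ʳ Y x^1∣X))) (one-inv (one-pochInf 2 x^1∣x²yq²))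

one-RHS : OneAtX⁰ RHS
one-RHS = one-at-x⁰ (x⁰-coeff one-term₀)
  where
  x^1∣x²y² : x^ 1 ∣ X ^s 2 *s Y ^s 2 *s Q ^s 0
  x^1∣x²y² = x^∣-*ʳ (Q ^s 0) (x^∣-*ʳ (Y ^s 2) (x^∣-*ʳ (X *s 1s) x^1∣X))
  one-term₀ : OneAtX⁰ (term 0)
  one-term₀ = one-* (one-* (one-* (one-* (one-* one-1s one-1s) (one-- x^1∣x²y²)) one-1s) one-1s)
                    (one-inv (one-* one-1s one-1s))

QDifferenceEq-− : ∀ {F G} → QDifferenceEq F → QDifferenceEq G → QDifferenceEq (F -s G)
QDifferenceEq-− {F} {G} F-eq G-eq = begin
  U *s σ (F -s G)           ≈⟨ S.*-congˡ {U} (σ-- F G) ⟩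
  U *s (σ F -s σ G)         ≈⟨ x[y-z]≈xy-xz U (σ F) (σ G) ⟩
  U *s σ F -s U *s σ G      ≈⟨ S.+-cong F-eq (S.-‿cong G-eq) ⟩
  V *s F -s V *s G          ≈⟨ S.sym (x[y-z]≈xy-xz V F G) ⟩
  V *s (F -s G)             ∎

-- σ multiplies the coefficient of x^m by q^m, and q^m r = r forces r = 0 when m ≥ 1
QDifferenceEq-unique : ∀ F → QDifferenceEq F → x^ 1 ∣ F → F ≈ S.0#
QDifferenceEq-unique F F-eq x∣F =
  ⟦x⟧.twisted-equation-unique {U = U} {V} {F} (⟦y⟧.const-powersFixOnlyZero ⟦q⟧.t-powersFixOnlyZero)
    (x⁰-coeff one-U) (x⁰-coeff one-V)
    (S.trans (S.sym (*s≈*ₚ U (σ F))) (S.trans F-eq (*s≈*ₚ V F))) (x∣F 0 (s≤s z≤n))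

theorem2p1 : LHS ≈ RHS
theorem2p1 = x∙y⁻¹≈ε⇒x≈y LHS RHS
  (QDifferenceEq-unique (LHS -s RHS) (QDifferenceEq-− {LHS} {RHS} LHS-equation RHS-equation)
                        (x∣-difference one-LHS one-RHS))
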